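{- For all integers $r\geq 2$ and $n\geq 1$, $$R_r(S_{n,n})\leq \left(r-\tfrac{1}{2}\right)(2n+2)-1.$$
   Context: For nonnegative integers $k,l$, the double star $S_{k,l}$ is the tree obtained by joining by an edge the centers of two vertex-disjoint stars having $k$ and $l$ leaves respectively; so $|V(S_{k,l})|=k+l+2$. The balanced double star is $S_{n,n}$. For a graph $G$ and positive integer $r$, $R_r(G)$ denotes the smallest integer $N$ such that in every coloring of the edges of the complete graph $K_N$ with $r$ colors there is a monochromatic copy of $G$ (i.e. a subgraph isomorphic to $G$ all of whose edges have the same color). -}

module Defs where

open import Data.Nat using (ℕ; zero; suc; _+_; _*_; _∸_; _≤_; _<_)
open import Data.Fin using (Fin; toℕ)
open import Data.Product using (Σ; _×_; ∃)
open import Data.Sum using (_⊎_)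
open import Relation.Binary.PropositionalEquality using (_≡_; _≢_)
open import Function.Definitions using (Injective)

-- The double star S_{k,l} on vertex set Fin (k + l + 2):
-- vertex 0 and vertex 1 are the two centres (joined by an edge),
-- vertices 2, ..., k+1 are the k leaves attached to centre 0,
-- vertices k+2, ..., k+l+1 are the l leaves attached to centre 1.
-- DSEdge k l x y : there is an edge of S_{k,l} directed x → y
-- (the edge set is the symmetrisation of this relation).
data DSEdge (k l : ℕ) : Fin (k + l + 2) → Fin (k + l + 2) → Set where
  centres : ∀ {x y} → toℕ x ≡ 0 → toℕ y ≡ 1 → DSEdge k l x y
  leaf₀   : ∀ {x y} → toℕ x ≡ 0 → 2 ≤ toℕ y → toℕ y < k + 2 → DSEdge k l x y
  leaf₁   : ∀ {x y} → toℕ x ≡ 1 → k + 2 ≤ toℕ y → DSEdge k l x y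

DSAdj : (k l : ℕ) → Fin (k + l + 2) → Fin (k + l + 2) → Set
DSAdj k l x y = DSEdge k l x y ⊎ DSEdge k l y x

-- An r-colouring of the edges of K_N: a colour for each pair of distinct
-- vertices, symmetric in the two endpoints (values on the diagonal are irrelevant).
record Colouring (r N : ℕ) : Set where
  field
    colour : Fin N → Fin N → Fin r
    symm   : ∀ x y → colour x y ≡ colour y x
open Colouring public

MonoDoubleStar : ∀ {r N} → Colouring r N → Fin r → (k l : ℕ) → Set
MonoDoubleStar {r} {N} χ c k l =
  Σ (Fin (k + l + 2) → Fin N) λ f →
    Injective _≡_ _≡_ f ×
    (∀ x y → DSAdj k l x y → colour χ (f x) (f y) ≡ c)

Arrows : (N r k l : ℕ) → Set
Arrows N r k l = (χ : Colouring r N) → Σ (Fin r) λ c → MonoDoubleStar χ c k l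

-- R_r(S_{k,l}) ≤ B  :⇔  the least N with K_N → (S_{k,l})_r is at most B,
-- i.e. some N ≤ B satisfies the arrow property.
RamseyLe : (r k l B : ℕ) → Set
RamseyLe r k l B = Σ ℕ λ N → N ≤ B × Arrows N r k l

{-# OPTIONS --safe #-}

-- Suppose an r-colouring of K_N has no monochromatic S_{n,n}.  Then no edge xy, of colour a,
-- is good: x and y each have more than n neighbours of colour a and together at least 2n
-- further ones, for then Hall's condition gives the two sets of n leaves.  Weighting the
-- colour classes at a vertex by 2, 1 or 0 as their size is at most n, at most 2n or larger,
-- every edge collects weight at least 2 at its ends, while a vertex hands out less than its
-- degree N - 1 unless all its colour degrees lie in (n, 2n]; double counting puts every
-- colour degree in that window.  Now the vertices outside an edge xy split into fewer than
-- 2n neighbours of x or y in colour a, those seeing x and y in one other colour, and the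
-- rainbow ones.  The second kind is bounded by the slacks 2n - deg of x, the rainbow ones,
-- grouped by their colour pair, by Cauchy–Schwarz and the slacks of the rainbow vertex.
-- Summed over ordered pairs these give four linear inequalities in three totals, which
-- are inconsistent when N = (2r - 1)(n + 1) - 1.

module Submission where

open import Data.Bool using (Bool; true; false; _∧_; _∨_; not)
open import Data.Bool.Properties using (∧-identityʳ)
open import Data.Empty using (⊥; ⊥-elim)
open import Data.Fin using (Fin; zero; suc; toℕ; fromℕ<; _≟_)
open import Data.Fin.Properties using (any?)
import Data.Fin.Properties as Fin
open import Data.List using (_∷_; [])
open import Data.Nat
  using (ℕ; zero; suc; _+_; _*_; _∸_; _≤_; _<_; _≤?_; _<?_; z≤n; s≤s; s≤s⁻¹; z<s; >-nonZero)
open import Data.Nat.Properties hiding (_≟_)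
open import Data.Nat.Tactic.RingSolver using (solve; solve-∀)
open import Algebra.Properties.CommutativeSemigroup *-commutativeSemigroup using (x∙yz≈y∙xz)
open import Algebra.Properties.Semiring.Sum +-*-semiring
  using (sum; sum-cong-≗; ∑-distrib-+; ∑-comm; *-distribˡ-sum; *-distribʳ-sum)
open import Data.Product using (Σ-syntax; ∃; ∃-syntax; _×_; _,_; proj₁; proj₂)
open import Data.Sum using (_⊎_; inj₁; inj₂; [_,_]′)
open import Function using (_∘_; id)
open import Function.Definitions using (Injective)
open import Relation.Binary.PropositionalEquality
open import Relation.Nullary using (Dec; yes; no; does; ¬_)
open import Relation.Nullary.Decidable using (_×-dec_; ¬?)
open import Defs

sum-mono-≤ : ∀ {N} {f g : Fin N → ℕ} → (∀ i → f i ≤ g i) → sum f ≤ sum g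
sum-mono-≤ {zero}  f≤g = z≤n
sum-mono-≤ {suc N} f≤g = +-mono-≤ (f≤g zero) (sum-mono-≤ (f≤g ∘ suc))

sum-mono-< : ∀ {N} {f g : Fin N → ℕ} (i : Fin N) →
  (∀ j → f j ≤ g j) → f i < g i → sum f < sum g
sum-mono-< zero    f≤g fi<gi = +-mono-<-≤ fi<gi (sum-mono-≤ (f≤g ∘ suc))
sum-mono-< (suc i) f≤g fi<gi = +-mono-≤-< (f≤g zero) (sum-mono-< i (f≤g ∘ suc) fi<gi)

sum-const : ∀ N c → sum {N} (λ _ → c) ≡ N * c
sum-const zero    c = refl
sum-const (suc N) c = cong (c +_) (sum-const N c)

⟦_⟧ : Bool → ℕ
⟦ true ⟧  = 1
⟦ false ⟧ = 0

⟦⟧≤1 : ∀ b → ⟦ b ⟧ ≤ 1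
⟦⟧≤1 true  = ≤-refl
⟦⟧≤1 false = z≤n

⟦∧⟧ : ∀ a b → ⟦ a ∧ b ⟧ ≡ ⟦ a ⟧ * ⟦ b ⟧
⟦∧⟧ true  b = sym (+-identityʳ ⟦ b ⟧)
⟦∧⟧ false b = refl

∧-true : ∀ {a b} → a ∧ b ≡ true → a ≡ true × b ≡ true
∧-true {true} b≡true = refl , b≡true

∧-intro : ∀ {a b} → a ≡ true → b ≡ true → a ∧ b ≡ true
∧-intro refl b≡true = b≡true

not-intro : ∀ {a} → a ≡ false → not a ≡ true
not-intro refl = refl

⟦⟧≤-cover₃ : ∀ {b c₁ c₂ c₃} → (b ≡ true → c₁ ≡ true ⊎ c₂ ≡ true ⊎ c₃ ≡ true) →
  ⟦ b ⟧ ≤ ⟦ c₁ ⟧ + ⟦ c₂ ⟧ + ⟦ c₃ ⟧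
⟦⟧≤-cover₃ {false} _ = z≤n
⟦⟧≤-cover₃ {true} {c₁} {c₂} {c₃} cover with cover refl
... | inj₁ refl        = s≤s z≤n
... | inj₂ (inj₁ refl) = ≤-trans (m≤n+m 1 ⟦ c₁ ⟧) (m≤m+n (⟦ c₁ ⟧ + 1) ⟦ c₃ ⟧)
... | inj₂ (inj₂ refl) = m≤n+m 1 (⟦ c₁ ⟧ + ⟦ c₂ ⟧)

⟦∧⟧≤ˡ : ∀ a b → ⟦ a ∧ b ⟧ ≤ ⟦ a ⟧
⟦∧⟧≤ˡ true  b = ⟦⟧≤1 b
⟦∧⟧≤ˡ false b = z≤n

⟦∧⟧≤ʳ : ∀ a b → ⟦ a ∧ b ⟧ ≤ ⟦ b ⟧
⟦∧⟧≤ʳ true  b = ≤-refl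
⟦∧⟧≤ʳ false b = z≤n

⟦⟧*-mono : ∀ b {m n} → (b ≡ true → m ≤ n) → ⟦ b ⟧ * m ≤ ⟦ b ⟧ * n
⟦⟧*-mono true  m≤n = *-monoʳ-≤ 1 (m≤n refl)
⟦⟧*-mono false _   = z≤n

count : ∀ {N} → (Fin N → Bool) → ℕ
count P = sum (λ i → ⟦ P i ⟧)

count≤ : ∀ {N} (P : Fin N → Bool) → count P ≤ N
count≤ {N} P = ≤-trans (sum-mono-≤ (⟦⟧≤1 ∘ P)) (≤-reflexive (trans (sum-const N 1) (*-identityʳ N)))

_==_ : ∀ {n} → Fin n → Fin n → Bool
a == b = does (a ≟ b)

==⇒≡ : ∀ {n} {a b : Fin n} → (a == b) ≡ true → a ≡ b
==⇒≡ {a = a} {b} eq with a ≟ b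
... | yes a≡b = a≡b

≡⇒== : ∀ {n} {a b : Fin n} → a ≡ b → (a == b) ≡ true
≡⇒== {a = a} refl with a ≟ a
... | yes _  = refl
... | no a≢a = ⊥-elim (a≢a refl)

≢⇒== : ∀ {n} {a b : Fin n} → a ≢ b → (a == b) ≡ false
≢⇒== {a = a} {b} a≢b with a ≟ b
... | yes a≡b = ⊥-elim (a≢b a≡b)
... | no _    = refl

not-==⇒≢ : ∀ {n} {a b : Fin n} → not (a == b) ≡ true → a ≢ b
not-==⇒≢ {a = a} a≠b refl rewrite ≡⇒== {a = a} refl with a≠b
... | ()

≢⇒not-== : ∀ {n} {a b : Fin n} → a ≢ b → not (a == b) ≡ true
≢⇒not-== a≢b rewrite ≢⇒== a≢b = refl

==-sym : ∀ {n} (a b : Fin n) → (a == b) ≡ (b == a)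
==-sym a b with a ≟ b | b ≟ a
... | yes _   | yes _   = refl
... | yes a≡b | no b≢a  = ⊥-elim (b≢a (sym a≡b))
... | no a≢b  | yes b≡a = ⊥-elim (a≢b (sym b≡a))
... | no _    | no _    = refl

sum-pick : ∀ {N} (j : Fin N) (f : Fin N → ℕ) → sum (λ i → ⟦ j == i ⟧ * f i) ≡ f j
sum-pick {suc N} zero f = begin
  (f zero + 0) + sum {N} (λ _ → 0)   ≡⟨ cong₂ _+_ (+-identityʳ (f zero)) (sum-const N 0) ⟩
  f zero + N * 0                     ≡⟨ cong (f zero +_) (*-zeroʳ N) ⟩
  f zero + 0                         ≡⟨ +-identityʳ (f zero) ⟩
  f zero                             ∎
  where open ≡-Reasoning
sum-pick {suc N} (suc j) f = begin
  ⟦ suc j == zero ⟧ * f zero + sum (λ i → ⟦ suc j == suc i ⟧ * f (suc i))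
    ≡⟨ sum-cong-≗ (λ i → cong (λ b → ⟦ b ⟧ * f (suc i)) (suc-== i)) ⟩
  sum (λ i → ⟦ j == i ⟧ * f (suc i)) ≡⟨ sum-pick j (f ∘ suc) ⟩
  f (suc j) ∎
  where
  open ≡-Reasoning
  suc-== : ∀ i → (suc j == suc i) ≡ (j == i)
  suc-== i with j ≟ i
  ... | yes _ = refl
  ... | no _  = refl

count-not : ∀ {N} (P : Fin N → Bool) → count (not ∘ P) + count P ≡ N
count-not {N} P = begin
  count (not ∘ P) + count P           ≡⟨ ∑-distrib-+ (λ i → ⟦ not (P i) ⟧) (λ i → ⟦ P i ⟧) ⟨
  sum (λ i → ⟦ not (P i) ⟧ + ⟦ P i ⟧) ≡⟨ sum-cong-≗ (λ i → ⟦not⟧+⟦⟧ (P i)) ⟩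
  sum {N} (λ _ → 1)                   ≡⟨ sum-const N 1 ⟩
  N * 1                               ≡⟨ *-identityʳ N ⟩
  N                                   ∎
  where
  open ≡-Reasoning
  ⟦not⟧+⟦⟧ : ∀ b → ⟦ not b ⟧ + ⟦ b ⟧ ≡ 1
  ⟦not⟧+⟦⟧ true  = refl
  ⟦not⟧+⟦⟧ false = refl

count-== : ∀ {N} (j : Fin N) → count (j ==_) ≡ 1
count-== j = trans (sum-cong-≗ (λ i → sym (*-identityʳ ⟦ j == i ⟧))) (sum-pick j (λ _ → 1))

count-≢ : ∀ {N} (j : Fin N) → count (λ i → not (j == i)) + 1 ≡ N
count-≢ j = trans (cong (count (λ i → not (j == i)) +_) (sym (count-== j))) (count-not (j ==_))

sum-bump-≤ : ∀ {N} (f : Fin N → ℕ) j a b → (∀ i → f i + ⟦ j == i ⟧ * a ≤ b) → sum f + a ≤ N * b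
sum-bump-≤ {N} f j a b bound = begin
  sum f + a                                ≡⟨ cong (sum f +_) (sum-pick j (λ _ → a)) ⟨
  sum f + sum (λ i → ⟦ j == i ⟧ * a)        ≡⟨ ∑-distrib-+ f (λ i → ⟦ j == i ⟧ * a) ⟨
  sum (λ i → f i + ⟦ j == i ⟧ * a)          ≤⟨ sum-mono-≤ bound ⟩
  sum {N} (λ _ → b)                        ≡⟨ sum-const N b ⟩
  N * b                                    ∎
  where open ≤-Reasoning

sum-fibres : ∀ {N r} (κ : Fin N → Fin r) (f : Fin N → Fin r → ℕ) →
  sum (λ z → f z (κ z)) ≡ sum (λ b → sum (λ z → ⟦ κ z == b ⟧ * f z b))
sum-fibres κ f = trans (sum-cong-≗ (λ z → sym (sum-pick (κ z) (f z)))) (∑-comm (λ z b → ⟦ κ z == b ⟧ * f z b))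

∑∑ : ∀ {m n} → (Fin m → Fin n → ℕ) → ℕ
∑∑ f = sum (λ b → sum (f b))

∑∑-cong : ∀ {m n} {f g : Fin m → Fin n → ℕ} → (∀ b e → f b e ≡ g b e) → ∑∑ f ≡ ∑∑ g
∑∑-cong f≡g = sum-cong-≗ (λ b → sum-cong-≗ (f≡g b))

∑∑-mono : ∀ {m n} {f g : Fin m → Fin n → ℕ} → (∀ b e → f b e ≤ g b e) → ∑∑ f ≤ ∑∑ g
∑∑-mono f≤g = sum-mono-≤ (λ b → sum-mono-≤ (f≤g b))

∑∑-+ : ∀ {m n} (f g : Fin m → Fin n → ℕ) → ∑∑ (λ b e → f b e + g b e) ≡ ∑∑ f + ∑∑ g
∑∑-+ f g = trans (sum-cong-≗ (λ b → ∑-distrib-+ (f b) (g b))) (∑-distrib-+ (λ b → sum (f b)) (λ b → sum (g b)))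

∑∑-*ˡ : ∀ {m n} c (f : Fin m → Fin n → ℕ) → c * ∑∑ f ≡ ∑∑ (λ b e → c * f b e)
∑∑-*ˡ c f = trans (*-distribˡ-sum c (λ b → sum (f b))) (sum-cong-≗ (λ b → *-distribˡ-sum c (f b)))

∑∑-*ʳ : ∀ {m n} c (f : Fin m → Fin n → ℕ) → ∑∑ f * c ≡ ∑∑ (λ b e → f b e * c)
∑∑-*ʳ c f = trans (*-distribʳ-sum c (λ b → sum (f b))) (sum-cong-≗ (λ b → *-distribʳ-sum c (f b)))

*-cancelˡ-≤′ : ∀ c {a b} → c * a ≤ c * b → (c ≡ 0 → a ≡ 0) → a ≤ b
*-cancelˡ-≤′ zero    _   a≡0 = subst (_≤ _) (sym (a≡0 refl)) z≤n
*-cancelˡ-≤′ (suc c) ca≤cb _ = *-cancelˡ-≤ (suc c) ca≤cb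

am-gm-≤ : ∀ {a b} → a ≤ b → 2 * (a * b) ≤ a * a + b * b
am-gm-≤ {a} a≤b with m≤n⇒∃[o]m+o≡n a≤b
... | d , refl = subst (2 * (a * (a + d)) ≤_) (square-gap a d) (m≤m+n _ (d * d))
  where
  square-gap : ∀ a d → 2 * (a * (a + d)) + d * d ≡ a * a + (a + d) * (a + d)
  square-gap = solve-∀

am-gm : ∀ a b → 2 * (a * b) ≤ a * a + b * b
am-gm a b with ≤-total a b
... | inj₁ a≤b = am-gm-≤ a≤b
... | inj₂ b≤a = subst₂ _≤_ (cong (2 *_) (*-comm b a)) (+-comm (b * b) (a * a)) (am-gm-≤ b≤a)

sum-sq≤ : ∀ {N} (f : Fin N → ℕ) → sum f * sum f ≤ N * sum (λ i → f i * f i)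
sum-sq≤ {N} f = *-cancelˡ-≤ 2 (begin
  2 * (sum f * sum f)
    ≡⟨ cong (2 *_) (sum-*-sum f f) ⟩
  2 * sum (λ i → sum (λ j → f i * f j))
    ≡⟨ *-distribˡ-sum 2 (λ i → sum (λ j → f i * f j)) ⟩
  sum (λ i → 2 * sum (λ j → f i * f j))
    ≡⟨ sum-cong-≗ (λ i → *-distribˡ-sum 2 (λ j → f i * f j)) ⟩
  sum (λ i → sum (λ j → 2 * (f i * f j)))
    ≤⟨ sum-mono-≤ (λ i → sum-mono-≤ (λ j → am-gm (f i) (f j))) ⟩
  sum (λ i → sum (λ j → f i * f i + f j * f j))
    ≡⟨ sum-cong-≗ (λ i → ∑-distrib-+ (λ _ → f i * f i) (λ j → f j * f j)) ⟩
  sum (λ i → sum {N} (λ _ → f i * f i) + S₂)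
    ≡⟨ sum-cong-≗ (λ i → cong (_+ S₂) (sum-const N (f i * f i))) ⟩
  sum (λ i → N * (f i * f i) + S₂)
    ≡⟨ ∑-distrib-+ (λ i → N * (f i * f i)) (λ _ → S₂) ⟩
  sum (λ i → N * (f i * f i)) + sum {N} (λ _ → S₂)
    ≡⟨ cong₂ _+_ (*-distribˡ-sum N (λ i → f i * f i)) (sym (sum-const N S₂)) ⟨
  N * S₂ + N * S₂
    ≡⟨ cong (N * S₂ +_) (+-identityʳ (N * S₂)) ⟨
  2 * (N * S₂) ∎)
  where
  open ≤-Reasoning
  S₂ = sum (λ i → f i * f i)
  sum-*-sum : ∀ {N} (f g : Fin N → ℕ) → sum f * sum g ≡ sum (λ i → sum (λ j → f i * g j))
  sum-*-sum f g = trans (*-distribʳ-sum (sum g) f) (sum-cong-≗ (λ i → *-distribˡ-sum (f i) g))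

count-≢₂ : ∀ {N} {a b : Fin N} → a ≢ b → count (λ i → not (a == i) ∧ not (b == i)) + 1 + 1 ≡ N
count-≢₂ {N} {a} {b} a≢b = begin
  count avoid + 1 + 1
    ≡⟨ cong₂ (λ u v → count avoid + u + v) (count-== a) (count-== b) ⟨
  count avoid + count (a ==_) + count (b ==_)
    ≡⟨ cong (_+ count (b ==_)) (∑-distrib-+ (λ i → ⟦ avoid i ⟧) (λ i → ⟦ a == i ⟧)) ⟨
  sum (λ i → ⟦ avoid i ⟧ + ⟦ a == i ⟧) + count (b ==_)
    ≡⟨ ∑-distrib-+ (λ i → ⟦ avoid i ⟧ + ⟦ a == i ⟧) (λ i → ⟦ b == i ⟧) ⟨
  sum (λ i → ⟦ avoid i ⟧ + ⟦ a == i ⟧ + ⟦ b == i ⟧)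
    ≡⟨ sum-cong-≗ one ⟩
  sum {N} (λ _ → 1)
    ≡⟨ sum-const N 1 ⟩
  N * 1
    ≡⟨ *-identityʳ N ⟩
  N ∎
  where
  open ≡-Reasoning
  avoid : Fin N → Bool
  avoid i = not (a == i) ∧ not (b == i)
  one : ∀ i → ⟦ avoid i ⟧ + ⟦ a == i ⟧ + ⟦ b == i ⟧ ≡ 1
  one i with a ≟ i | b ≟ i
  ... | yes refl | yes refl = ⊥-elim (a≢b refl)
  ... | yes _    | no _     = refl
  ... | no _     | yes _    = refl
  ... | no _     | no _     = refl

distinct₃ : ∀ {r} → Fin r → Fin r → Fin r → Bool
distinct₃ a b e = not (b == a) ∧ not (e == a) ∧ not (b == e)

count-distinct₃ : ∀ {r} (a : Fin r) → sum (λ b → count (distinct₃ a b)) ≡ (r ∸ 1) * (r ∸ 2)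
count-distinct₃ {r} a = begin
  sum (λ b → count (distinct₃ a b))        ≡⟨ sum-cong-≗ per-colour ⟩
  sum (λ b → ⟦ not (a == b) ⟧ * (r ∸ 2))   ≡⟨ *-distribʳ-sum (r ∸ 2) (λ b → ⟦ not (a == b) ⟧) ⟨
  count (λ b → not (a == b)) * (r ∸ 2)     ≡⟨ cong (_* (r ∸ 2)) (∸-from-+ {k = 1} (count-≢ a)) ⟩
  (r ∸ 1) * (r ∸ 2)                        ∎
  where
  open ≡-Reasoning
  ∸-from-+ : ∀ {c k m} → c + k ≡ m → c ≡ m ∸ k
  ∸-from-+ {c} {k} refl = sym (m+n∸n≡m c k)
  per-colour : ∀ b → count (distinct₃ a b) ≡ ⟦ not (a == b) ⟧ * (r ∸ 2)
  per-colour b with a ≟ b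
  ... | yes refl = trans (sum-cong-≗ (λ e → cong (λ t → ⟦ not t ∧ (not (e == a) ∧ not (a == e)) ⟧) (≡⇒== {a = a} refl)))
                         (trans (sum-const r 0) (*-zeroʳ r))
  ... | no a≢b = begin
    count (distinct₃ a b)
      ≡⟨ sum-cong-≗ (λ e → cong₂ (λ s t → ⟦ not s ∧ not t ∧ not (b == e) ⟧) (≢⇒== (a≢b ∘ sym)) (==-sym e a)) ⟩
    count (λ e → not (a == e) ∧ not (b == e))
      ≡⟨ ∸-from-+ (trans (sym (+-assoc _ 1 1)) (count-≢₂ a≢b)) ⟩
    r ∸ 2
      ≡⟨ +-identityʳ (r ∸ 2) ⟨
    1 * (r ∸ 2) ∎

select : ∀ {N} (P : Fin N → Bool) k → k ≤ count P →
  Σ[ g ∈ (Fin k → Fin N) ] (∀ i → P (g i) ≡ true) × Injective _≡_ _≡_ g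
select P zero _ = (λ ()) , (λ ()) , λ { {()} }
select {suc N} P (suc k) k≤P with P zero in P0
... | true =
  let g , g∈P , g-inj = select (P ∘ suc) k (s≤s⁻¹ k≤P) in
  (λ { zero → zero ; (suc i) → suc (g i) }) ,
  (λ { zero → P0 ; (suc i) → g∈P i }) ,
  λ { {zero} {zero} _ → refl
    ; {suc i} {suc j} eq → cong suc (g-inj (Fin.suc-injective eq)) }
... | false =
  let g , g∈P , g-inj = select (P ∘ suc) (suc k) k≤P in
  suc ∘ g , g∈P , g-inj ∘ Fin.suc-injective

record Split {N} (P Q : Fin N → Bool) (p q : ℕ) : Set where
  field
    P′ Q′    : Fin N → Bool
    P′⊆P     : ∀ i → P′ i ≡ true → P i ≡ true
    Q′⊆Q     : ∀ i → Q′ i ≡ true → Q i ≡ true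
    disjoint : ∀ i → P′ i ≡ true → Q′ i ≡ false
    p≤P′     : p ≤ count P′
    q≤Q′     : q ≤ count Q′

split-extend : ∀ {N} {P Q : Fin (suc N) → Bool} {p q} (a b : Bool) →
  (a ≡ true → P zero ≡ true) → (b ≡ true → Q zero ≡ true) → (a ≡ true → b ≡ false) →
  Split (P ∘ suc) (Q ∘ suc) p q → Split P Q (⟦ a ⟧ + p) (⟦ b ⟧ + q)
split-extend a b a⇒P b⇒Q a⇒¬b s = record
  { P′       = λ { zero → a ; (suc i) → P′ i }
  ; Q′       = λ { zero → b ; (suc i) → Q′ i }
  ; P′⊆P     = λ { zero → a⇒P ; (suc i) → P′⊆P i }
  ; Q′⊆Q     = λ { zero → b⇒Q ; (suc i) → Q′⊆Q i }
  ; disjoint = λ { zero → a⇒¬b ; (suc i) → disjoint i }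
  ; p≤P′     = +-monoʳ-≤ ⟦ a ⟧ p≤P′
  ; q≤Q′     = +-monoʳ-≤ ⟦ b ⟧ q≤Q′
  }
  where open Split s

count-∨ : ∀ {N} (P Q : Fin N → Bool) → count (λ i → P i ∨ Q i) ≤ count P + count Q
count-∨ P Q = ≤-trans (sum-mono-≤ (λ i → ⟦∨⟧≤ (P i) (Q i))) (≤-reflexive (∑-distrib-+ (λ i → ⟦ P i ⟧) (λ i → ⟦ Q i ⟧)))
  where
  ⟦∨⟧≤ : ∀ a b → ⟦ a ∨ b ⟧ ≤ ⟦ a ⟧ + ⟦ b ⟧
  ⟦∨⟧≤ true  b = s≤s z≤n
  ⟦∨⟧≤ false b = ≤-refl

-- Hall's condition for two sets, proved greedily: a point of P ∩ Q goes to P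
-- unless Q would otherwise run short.
split : ∀ {N} (P Q : Fin N → Bool) p q → p ≤ count P → q ≤ count Q →
  p + q ≤ count (λ i → P i ∨ Q i) → Split P Q p q
split P Q zero q _ q≤Q _ = record
  { P′ = λ _ → false ; Q′ = Q ; P′⊆P = λ _ () ; Q′⊆Q = λ _ → id
  ; disjoint = λ _ () ; p≤P′ = z≤n ; q≤Q′ = q≤Q }
split P Q (suc p) zero p≤P _ _ = record
  { P′ = P ; Q′ = λ _ → false ; P′⊆P = λ _ → id ; Q′⊆Q = λ _ ()
  ; disjoint = λ _ _ → refl ; p≤P′ = p≤P ; q≤Q′ = z≤n }
split {suc N} P Q (suc p) (suc q) p≤P q≤Q pq≤P∨Q with P zero in P0 | Q zero in Q0
... | false | false = split-extend false false (λ ()) (λ ()) (λ ())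
      (split (P ∘ suc) (Q ∘ suc) (suc p) (suc q) p≤P q≤Q pq≤P∨Q)
... | true | false = split-extend true false (λ _ → P0) (λ ()) (λ _ → refl)
      (split (P ∘ suc) (Q ∘ suc) p (suc q) (s≤s⁻¹ p≤P) q≤Q (s≤s⁻¹ pq≤P∨Q))
... | false | true = split-extend false true (λ ()) (λ _ → Q0) (λ ())
      (split (P ∘ suc) (Q ∘ suc) (suc p) q p≤P (s≤s⁻¹ q≤Q)
        (s≤s⁻¹ (subst (_≤ suc (count (λ i → P (suc i) ∨ Q (suc i)))) (+-suc (suc p) q) pq≤P∨Q)))
... | true | true with suc q ≤? count (Q ∘ suc)
...   | yes q≤Q′ = split-extend true false (λ _ → P0) (λ ()) (λ _ → refl)
      (split (P ∘ suc) (Q ∘ suc) p (suc q) (s≤s⁻¹ p≤P) q≤Q′ (s≤s⁻¹ pq≤P∨Q))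
...   | no q≰Q′ = split-extend false true (λ ()) (λ _ → Q0) (λ ())
      (split (P ∘ suc) (Q ∘ suc) (suc p) q p≤P′ (s≤s⁻¹ q≤Q) pq≤P∨Q′)
  where
  pq≤P∨Q′ : suc p + q ≤ count (λ i → P (suc i) ∨ Q (suc i))
  pq≤P∨Q′ = s≤s⁻¹ (subst (_≤ suc (count (λ i → P (suc i) ∨ Q (suc i)))) (+-suc (suc p) q) pq≤P∨Q)
  p≤P′ : suc p ≤ count (P ∘ suc)
  p≤P′ = +-cancelʳ-≤ q (suc p) _ (begin
    suc p + q                           ≤⟨ pq≤P∨Q′ ⟩
    count (λ i → P (suc i) ∨ Q (suc i)) ≤⟨ count-∨ (P ∘ suc) (Q ∘ suc) ⟩
    count (P ∘ suc) + count (Q ∘ suc)   ≤⟨ +-monoʳ-≤ (count (P ∘ suc)) (s≤s⁻¹ (≰⇒> q≰Q′)) ⟩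
    count (P ∘ suc) + q                 ∎)
    where open ≤-Reasoning

record DisjointSelection {N} (P Q : Fin N → Bool) (p q : ℕ) : Set where
  field
    g     : Fin p → Fin N
    h     : Fin q → Fin N
    g∈P   : ∀ i → P (g i) ≡ true
    h∈Q   : ∀ j → Q (h j) ≡ true
    g-inj : Injective _≡_ _≡_ g
    h-inj : Injective _≡_ _≡_ h
    g≢h   : ∀ i j → g i ≢ h j

select-disjoint : ∀ {N} (P Q : Fin N → Bool) p q → p ≤ count P → q ≤ count Q →
  p + q ≤ count (λ i → P i ∨ Q i) → DisjointSelection P Q p q
select-disjoint {N} P Q p q p≤P q≤Q pq≤P∨Q = record
  { g     = g
  ; h     = h
  ; g∈P   = λ i → P′⊆P (g i) (g∈P′ i)
  ; h∈Q   = λ j → Q′⊆Q (h j) (h∈Q′ j)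
  ; g-inj = g-inj
  ; h-inj = h-inj
  ; g≢h   = λ i j gi≡hj → false≢true (trans (sym (disjoint (g i) (g∈P′ i))) (trans (cong Q′ gi≡hj) (h∈Q′ j)))
  }
  where
  open Split (split P Q p q p≤P q≤Q pq≤P∨Q)
  false≢true : false ≢ true
  false≢true ()
  g : Fin p → Fin N
  g = proj₁ (select P′ p p≤P′)
  g∈P′ : ∀ i → P′ (g i) ≡ true
  g∈P′ = proj₁ (proj₂ (select P′ p p≤P′))
  g-inj : Injective _≡_ _≡_ g
  g-inj = proj₂ (proj₂ (select P′ p p≤P′))
  h : Fin q → Fin N
  h = proj₁ (select Q′ q q≤Q′)
  h∈Q′ : ∀ j → Q′ (h j) ≡ true
  h∈Q′ = proj₁ (proj₂ (select Q′ q q≤Q′))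
  h-inj : Injective _≡_ _≡_ h
  h-inj = proj₂ (proj₂ (select Q′ q q≤Q′))

-- Placing a double star

-- The vertices of S_{k,l} by their role; index is their number in the model of Defs.
data Role (k l : ℕ) : Set where
  centre₀ centre₁ : Role k l
  pendant₀        : Fin k → Role k l
  pendant₁        : Fin l → Role k l

data RoleEdge {k l : ℕ} : Role k l → Role k l → Set where
  centres : RoleEdge centre₀ centre₁
  spoke₀  : ∀ i → RoleEdge centre₀ (pendant₀ i)
  spoke₁  : ∀ j → RoleEdge centre₁ (pendant₁ j)

module _ {k l : ℕ} where

  index : Role k l → ℕ
  index centre₀      = 0
  index centre₁      = 1
  index (pendant₀ i) = 2 + toℕ i
  index (pendant₁ j) = 2 + (k + toℕ j)

  -- Outside 0 … k + l + 1 the value is junk.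
  roleAt : ℕ → Role k l
  roleAt 0 = centre₀
  roleAt 1 = centre₁
  roleAt (suc (suc j)) with j <? k
  ... | yes j<k = pendant₀ (fromℕ< j<k)
  ... | no _ with j ∸ k <? l
  ...   | yes j∸k<l = pendant₁ (fromℕ< j∸k<l)
  ...   | no _      = centre₀

  index-roleAt : ∀ j → j < k + l + 2 → index (roleAt j) ≡ j
  index-roleAt 0 _ = refl
  index-roleAt 1 _ = refl
  index-roleAt (suc (suc j)) j+2<k+l+2 with j <? k
  ... | yes j<k = cong (2 +_) (Fin.toℕ-fromℕ< j<k)
  ... | no j≮k with j ∸ k <? l
  ...   | yes j∸k<l = cong (2 +_) (trans (cong (k +_) (Fin.toℕ-fromℕ< j∸k<l)) (m+[n∸m]≡n (≮⇒≥ j≮k)))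
  ...   | no j∸k≮l = ⊥-elim (j∸k≮l (+-cancelˡ-< k (j ∸ k) l (begin-strict
            k + (j ∸ k) ≡⟨ m+[n∸m]≡n (≮⇒≥ j≮k) ⟩
            j           <⟨ +-cancelʳ-< 2 j (k + l) (subst (_< k + l + 2) (+-comm 2 j) j+2<k+l+2) ⟩
            k + l       ∎)))
    where open ≤-Reasoning

  roleAt-pendant₀ : ∀ j → 2 ≤ j → j < k + 2 → ∃[ i ] roleAt j ≡ pendant₀ i
  roleAt-pendant₀ 0 () _
  roleAt-pendant₀ 1 (s≤s ()) _
  roleAt-pendant₀ (suc (suc j)) _ j+2<k+2 with j <? k
  ... | yes j<k = fromℕ< j<k , refl
  ... | no j≮k  = ⊥-elim (j≮k (+-cancelʳ-< 2 j k (subst (_< k + 2) (+-comm 2 j) j+2<k+2)))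

  roleAt-pendant₁ : ∀ j → k + 2 ≤ j → j < k + l + 2 → ∃[ i ] roleAt j ≡ pendant₁ i
  roleAt-pendant₁ j k+2≤j j<k+l+2 with roleAt j | index-roleAt j j<k+l+2
  ... | centre₀    | refl = ⊥-elim (<⇒≱ (≤-trans (s≤s z≤n) (m≤n+m 2 k)) k+2≤j)
  ... | centre₁    | refl = ⊥-elim (<⇒≱ (m≤n+m 2 k) k+2≤j)
  ... | pendant₀ i | refl = ⊥-elim (<⇒≱ (subst (_< k + 2) (+-comm (toℕ i) 2) (+-monoˡ-< 2 (Fin.toℕ<n i))) k+2≤j)
  ... | pendant₁ i | _    = i , refl

  role : Fin (k + l + 2) → Role k l
  role v = roleAt (toℕ v)

  role-injective : Injective _≡_ _≡_ role
  role-injective {v} {w} eq = Fin.toℕ-injective (begin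
    toℕ v              ≡⟨ index-roleAt (toℕ v) (Fin.toℕ<n v) ⟨
    index (role v)     ≡⟨ cong index eq ⟩
    index (role w)     ≡⟨ index-roleAt (toℕ w) (Fin.toℕ<n w) ⟩
    toℕ w              ∎)
    where open ≡-Reasoning

  role-edge : ∀ {v w} → DSEdge k l v w → RoleEdge (role v) (role w)
  role-edge (centres v≡0 w≡1) = subst₂ RoleEdge (cong roleAt (sym v≡0)) (cong roleAt (sym w≡1)) centres
  role-edge {w = w} (leaf₀ v≡0 2≤w w<k+2) with roleAt-pendant₀ (toℕ w) 2≤w w<k+2
  ... | i , eq = subst₂ RoleEdge (cong roleAt (sym v≡0)) (sym eq) (spoke₀ i)
  role-edge {w = w} (leaf₁ v≡1 k+2≤w) with roleAt-pendant₁ (toℕ w) k+2≤w (Fin.toℕ<n w)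
  ... | j , eq = subst₂ RoleEdge (cong roleAt (sym v≡1)) (sym eq) (spoke₁ j)

monoDoubleStar-fromRoles : ∀ {r N k l} (χ : Colouring r N) (c : Fin r) (place : Role k l → Fin N) →
  Injective _≡_ _≡_ place → (∀ {ρ σ} → RoleEdge ρ σ → colour χ (place ρ) (place σ) ≡ c) →
  MonoDoubleStar χ c k l
monoDoubleStar-fromRoles χ c place place-inj mono =
  place ∘ role , role-injective ∘ place-inj , λ where
    v w (inj₁ e) → mono (role-edge e)
    v w (inj₂ e) → trans (symm χ (place (role v)) (place (role w))) (mono (role-edge e))

module _ {N k l : ℕ} (x y : Fin N) (L₀ : Fin k → Fin N) (L₁ : Fin l → Fin N) where

  placeStar : Role k l → Fin N
  placeStar centre₀      = x
  placeStar centre₁      = y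
  placeStar (pendant₀ i) = L₀ i
  placeStar (pendant₁ j) = L₁ j

  placeStar-injective : x ≢ y → Injective _≡_ _≡_ L₀ → Injective _≡_ _≡_ L₁ →
    (∀ i → x ≢ L₀ i × y ≢ L₀ i) → (∀ j → x ≢ L₁ j × y ≢ L₁ j) → (∀ i j → L₀ i ≢ L₁ j) →
    Injective _≡_ _≡_ placeStar
  placeStar-injective x≢y L₀-inj L₁-inj L₀-new L₁-new L₀≢L₁ {ρ} {σ} = injective ρ σ
    where
    injective : ∀ ρ σ → placeStar ρ ≡ placeStar σ → ρ ≡ σ
    injective centre₀      centre₀      _  = refl
    injective centre₀      centre₁      eq = ⊥-elim (x≢y eq)
    injective centre₀      (pendant₀ i) eq = ⊥-elim (proj₁ (L₀-new i) eq)
    injective centre₀      (pendant₁ j) eq = ⊥-elim (proj₁ (L₁-new j) eq)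
    injective centre₁      centre₀      eq = ⊥-elim (x≢y (sym eq))
    injective centre₁      centre₁      _  = refl
    injective centre₁      (pendant₀ i) eq = ⊥-elim (proj₂ (L₀-new i) eq)
    injective centre₁      (pendant₁ j) eq = ⊥-elim (proj₂ (L₁-new j) eq)
    injective (pendant₀ i) centre₀      eq = ⊥-elim (proj₁ (L₀-new i) (sym eq))
    injective (pendant₀ i) centre₁      eq = ⊥-elim (proj₂ (L₀-new i) (sym eq))
    injective (pendant₀ i) (pendant₀ j) eq = cong pendant₀ (L₀-inj eq)
    injective (pendant₀ i) (pendant₁ j) eq = ⊥-elim (L₀≢L₁ i j eq)
    injective (pendant₁ j) centre₀      eq = ⊥-elim (proj₁ (L₁-new j) (sym eq))
    injective (pendant₁ j) centre₁      eq = ⊥-elim (proj₂ (L₁-new j) (sym eq))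
    injective (pendant₁ j) (pendant₀ i) eq = ⊥-elim (L₀≢L₁ i j (sym eq))
    injective (pendant₁ i) (pendant₁ j) eq = cong pendant₁ (L₁-inj eq)

-- Colour degrees and good edges

module ColourDegrees {r N : ℕ} (χ : Colouring r N) where

  col : Fin N → Fin N → Fin r
  col = colour χ

  _≠ᵇ_ : Fin N → Fin N → Bool
  x ≠ᵇ z = not (x == z)

  ≠ᵇ-sym : ∀ x z → (x ≠ᵇ z) ≡ (z ≠ᵇ x)
  ≠ᵇ-sym x z = cong not (==-sym x z)

  nbr : Fin r → Fin N → Fin N → Bool
  nbr c x z = (x ≠ᵇ z) ∧ (col x z == c)

  deg : Fin r → Fin N → ℕ
  deg c x = count (nbr c x)

  outside : Fin N → Fin N → Fin N → Bool
  outside x y z = (x ≠ᵇ z) ∧ (y ≠ᵇ z)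

  nbrˣ nbrʸ : Fin N → Fin N → Fin N → Bool
  nbrˣ x y z = outside x y z ∧ (col x z == col x y)
  nbrʸ x y z = outside x y z ∧ (col y z == col x y)

  reach : Fin N → Fin N → ℕ
  reach x y = count (λ z → nbrˣ x y z ∨ nbrʸ x y z)

  count-nbrˣ : ∀ {x y} → x ≢ y → count (nbrˣ x y) + 1 ≡ deg (col x y) x
  count-nbrˣ {x} {y} x≢y = begin
    count (nbrˣ x y) + 1                  ≡⟨ cong (count (nbrˣ x y) +_) (count-== y) ⟨
    count (nbrˣ x y) + count (y ==_)      ≡⟨ ∑-distrib-+ (λ z → ⟦ nbrˣ x y z ⟧) (λ z → ⟦ y == z ⟧) ⟨
    sum (λ z → ⟦ nbrˣ x y z ⟧ + ⟦ y == z ⟧) ≡⟨ sum-cong-≗ pointwise ⟩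
    deg (col x y) x                       ∎
    where
    open ≡-Reasoning
    pointwise : ∀ z → ⟦ nbrˣ x y z ⟧ + ⟦ y == z ⟧ ≡ ⟦ nbr (col x y) x z ⟧
    pointwise z with y ≟ z
    ... | yes refl rewrite ≢⇒== x≢y | ≡⇒== {a = col x y} refl = refl
    ... | no _ rewrite ∧-identityʳ (x ≠ᵇ z) = +-identityʳ _

  count-nbrʸ : ∀ {x y} → x ≢ y → count (nbrʸ x y) + 1 ≡ deg (col x y) y
  count-nbrʸ {x} {y} x≢y = begin
    count (nbrʸ x y) + 1                  ≡⟨ cong (count (nbrʸ x y) +_) (count-== x) ⟨
    count (nbrʸ x y) + count (x ==_)      ≡⟨ ∑-distrib-+ (λ z → ⟦ nbrʸ x y z ⟧) (λ z → ⟦ x == z ⟧) ⟨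
    sum (λ z → ⟦ nbrʸ x y z ⟧ + ⟦ x == z ⟧) ≡⟨ sum-cong-≗ pointwise ⟩
    deg (col x y) y                       ∎
    where
    open ≡-Reasoning
    pointwise : ∀ z → ⟦ nbrʸ x y z ⟧ + ⟦ x == z ⟧ ≡ ⟦ nbr (col x y) y z ⟧
    pointwise z with x ≟ z
    ... | yes refl rewrite ≢⇒== (x≢y ∘ sym) | symm χ y x | ≡⇒== {a = col x y} refl = refl
    ... | no _ = +-identityʳ _

  Good : ℕ → ℕ → Fin N → Fin N → Set
  Good k l x y = x ≢ y × k < deg (col x y) x × l < deg (col x y) y × k + l ≤ reach x y

  good? : ∀ k l x y → Dec (Good k l x y)
  good? k l x y = ¬? (x ≟ y) ×-dec (k <? _) ×-dec (l <? _) ×-dec (k + l ≤? reach x y)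

  good⇒monoDoubleStar : ∀ {k l x y} → Good k l x y → MonoDoubleStar χ (col x y) k l
  good⇒monoDoubleStar {k} {l} {x} {y} (x≢y , k<dx , l<dy , k+l≤reach) =
    monoDoubleStar-fromRoles χ (col x y) (placeStar x y g h)
      (placeStar-injective x y g h x≢y g-inj h-inj g-new h-new g≢h) mono
    where
    k≤ : k ≤ count (nbrˣ x y)
    k≤ = m<1+n⇒m≤n (subst (k <_) (trans (sym (count-nbrˣ x≢y)) (+-comm _ 1)) k<dx)
    l≤ : l ≤ count (nbrʸ x y)
    l≤ = m<1+n⇒m≤n (subst (l <_) (trans (sym (count-nbrʸ x≢y)) (+-comm _ 1)) l<dy)
    open DisjointSelection (select-disjoint (nbrˣ x y) (nbrʸ x y) k l k≤ l≤ k+l≤reach)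
    g∈ : ∀ i → ((x ≠ᵇ g i) ≡ true × (y ≠ᵇ g i) ≡ true) × (col x (g i) == col x y) ≡ true
    g∈ i = let out , c = ∧-true (g∈P i) in ∧-true out , c
    h∈ : ∀ j → ((x ≠ᵇ h j) ≡ true × (y ≠ᵇ h j) ≡ true) × (col y (h j) == col x y) ≡ true
    h∈ j = let out , c = ∧-true (h∈Q j) in ∧-true out , c
    g-new : ∀ i → x ≢ g i × y ≢ g i
    g-new i = not-==⇒≢ (proj₁ (proj₁ (g∈ i))) , not-==⇒≢ (proj₂ (proj₁ (g∈ i)))
    h-new : ∀ j → x ≢ h j × y ≢ h j
    h-new j = not-==⇒≢ (proj₁ (proj₁ (h∈ j))) , not-==⇒≢ (proj₂ (proj₁ (h∈ j)))
    mono : ∀ {ρ σ} → RoleEdge ρ σ → col (placeStar x y g h ρ) (placeStar x y g h σ) ≡ col x y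
    mono centres    = refl
    mono (spoke₀ i) = ==⇒≡ (proj₂ (g∈ i))
    mono (spoke₁ j) = ==⇒≡ (proj₂ (h∈ j))

  monoDoubleStar-or-noGood : ∀ k l → (∃[ c ] MonoDoubleStar χ c k l) ⊎ (∀ x y → ¬ Good k l x y)
  monoDoubleStar-or-noGood k l with any? (λ x → any? (λ y → good? k l x y))
  ... | yes (x , y , good) = inj₁ (col x y , good⇒monoDoubleStar good)
  ... | no none            = inj₂ (λ x y good → none (x , y , good))

-- Every colour degree lies in (n, 2n]

module _ (n : ℕ) where

  weight : ℕ → ℕ
  weight d with d ≤? n | d ≤? n + n
  ... | yes _ | _     = 2
  ... | no _  | yes _ = 1
  ... | no _  | no _  = 0

  weight-low : ∀ {d} → d ≤ n → weight d ≡ 2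
  weight-low {d} d≤n with d ≤? n
  ... | yes _  = refl
  ... | no d≰n = ⊥-elim (d≰n d≤n)

  weight-mid : ∀ {d} → n < d → d ≤ n + n → weight d ≡ 1
  weight-mid {d} n<d d≤2n with d ≤? n | d ≤? n + n
  ... | yes d≤n | _       = ⊥-elim (<⇒≱ n<d d≤n)
  ... | no _    | yes _   = refl
  ... | no _    | no d≰2n = ⊥-elim (d≰2n d≤2n)

  weight-high : ∀ {d} → n + n < d → weight d ≡ 0
  weight-high {d} 2n<d with d ≤? n | d ≤? n + n
  ... | yes d≤n | _       = ⊥-elim (<⇒≱ 2n<d (≤-trans d≤n (m≤m+n n n)))
  ... | no _    | yes d≤2n = ⊥-elim (<⇒≱ 2n<d d≤2n)
  ... | no _    | no _     = refl

  *-weight≤ : ∀ d → d * weight d ≤ n + n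
  *-weight≤ d with d ≤? n | d ≤? n + n
  ... | yes d≤n | _       = subst (_≤ n + n) (sym (trans (*-comm d 2) (cong (d +_) (+-identityʳ d)))) (+-mono-≤ d≤n d≤n)
  ... | no _    | yes d≤2n = subst (_≤ n + n) (sym (*-identityʳ d)) d≤2n
  ... | no _    | no _     = subst (_≤ n + n) (sym (*-zeroʳ d)) z≤n

module Counting {r M : ℕ} (χ : Colouring r (suc M)) (n : ℕ) where

  open ColourDegrees χ public

  ∑≢ : Fin (suc M) → (Fin (suc M) → ℕ) → ℕ
  ∑≢ x f = sum (λ z → ⟦ x ≠ᵇ z ⟧ * f z)

  count-≠ᵇ : ∀ x → count (x ≠ᵇ_) ≡ M
  count-≠ᵇ x = suc-injective (trans (+-comm 1 _) (count-≢ x))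

  ∑≢-const : ∀ x c → ∑≢ x (λ _ → c) ≡ M * c
  ∑≢-const x c = trans (sym (*-distribʳ-sum c (λ z → ⟦ x ≠ᵇ z ⟧))) (cong (_* c) (count-≠ᵇ x))

  ∑≢-by-colour : ∀ x (f : Fin r → ℕ) → ∑≢ x (λ z → f (col x z)) ≡ sum (λ c → deg c x * f c)
  ∑≢-by-colour x f = sym (begin
    sum (λ c → deg c x * f c)
      ≡⟨ sum-cong-≗ (λ c → *-distribʳ-sum (f c) (λ z → ⟦ nbr c x z ⟧)) ⟩
    sum (λ c → sum (λ z → ⟦ nbr c x z ⟧ * f c))
      ≡⟨ ∑-comm (λ c z → ⟦ nbr c x z ⟧ * f c) ⟩
    sum (λ z → sum (λ c → ⟦ nbr c x z ⟧ * f c))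
      ≡⟨ sum-cong-≗ (λ z → sum-cong-≗ (λ c →
           trans (cong (_* f c) (⟦∧⟧ (x ≠ᵇ z) (col x z == c))) (*-assoc ⟦ x ≠ᵇ z ⟧ _ (f c)))) ⟩
    sum (λ z → sum (λ c → ⟦ x ≠ᵇ z ⟧ * (⟦ col x z == c ⟧ * f c)))
      ≡⟨ sum-cong-≗ (λ z → *-distribˡ-sum ⟦ x ≠ᵇ z ⟧ (λ c → ⟦ col x z == c ⟧ * f c)) ⟨
    sum (λ z → ⟦ x ≠ᵇ z ⟧ * sum (λ c → ⟦ col x z == c ⟧ * f c))
      ≡⟨ sum-cong-≗ (λ z → cong (⟦ x ≠ᵇ z ⟧ *_) (sum-pick (col x z) f)) ⟩
    ∑≢ x (λ z → f (col x z)) ∎)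
    where open ≡-Reasoning

  deg-sum : ∀ x → sum (λ c → deg c x) ≡ M
  deg-sum x = begin
    sum (λ c → deg c x)       ≡⟨ sum-cong-≗ (λ c → sym (*-identityʳ (deg c x))) ⟩
    sum (λ c → deg c x * 1)   ≡⟨ ∑≢-by-colour x (λ _ → 1) ⟨
    ∑≢ x (λ _ → 1)            ≡⟨ ∑≢-const x 1 ⟩
    M * 1                     ≡⟨ *-identityʳ M ⟩
    M                         ∎
    where open ≡-Reasoning

  degˣ≤reach+1 : ∀ {x y} → x ≢ y → deg (col x y) x ≤ reach x y + 1
  degˣ≤reach+1 {x} {y} x≢y = subst (_≤ reach x y + 1) (count-nbrˣ x≢y)
    (+-monoˡ-≤ 1 (sum-mono-≤ (λ z → ⟦⟧-mono-∨ˡ (nbrˣ x y z) (nbrʸ x y z))))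
    where
    ⟦⟧-mono-∨ˡ : ∀ a b → ⟦ a ⟧ ≤ ⟦ a ∨ b ⟧
    ⟦⟧-mono-∨ˡ true  b = ≤-refl
    ⟦⟧-mono-∨ˡ false b = z≤n

  degʸ≤reach+1 : ∀ {x y} → x ≢ y → deg (col x y) y ≤ reach x y + 1
  degʸ≤reach+1 {x} {y} x≢y = subst (_≤ reach x y + 1) (count-nbrʸ x≢y)
    (+-monoˡ-≤ 1 (sum-mono-≤ (λ z → ⟦⟧-mono-∨ʳ (nbrˣ x y z) (nbrʸ x y z))))
    where
    ⟦⟧-mono-∨ʳ : ∀ a b → ⟦ b ⟧ ≤ ⟦ a ∨ b ⟧
    ⟦⟧-mono-∨ʳ true  true  = ≤-refl
    ⟦⟧-mono-∨ʳ true  false = z≤n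
    ⟦⟧-mono-∨ʳ false b     = ≤-refl

  ∑≢-distrib-+ : ∀ x f g → ∑≢ x (λ z → f z + g z) ≡ ∑≢ x f + ∑≢ x g
  ∑≢-distrib-+ x f g = trans (sum-cong-≗ (λ z → *-distribˡ-+ ⟦ x ≠ᵇ z ⟧ (f z) (g z)))
    (∑-distrib-+ (λ z → ⟦ x ≠ᵇ z ⟧ * f z) (λ z → ⟦ x ≠ᵇ z ⟧ * g z))

  ∑pairs : (Fin (suc M) → Fin (suc M) → ℕ) → ℕ
  ∑pairs f = sum (λ x → ∑≢ x (f x))

  ∑pairs-mono : ∀ {f g} → (∀ x y → x ≢ y → f x y ≤ g x y) → ∑pairs f ≤ ∑pairs g
  ∑pairs-mono f≤g = sum-mono-≤ (λ x → sum-mono-≤ (λ y → ⟦⟧*-mono (x ≠ᵇ y) (f≤g x y ∘ not-==⇒≢)))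

  ∑pairs-swap : ∀ f → ∑pairs f ≡ ∑pairs (λ x y → f y x)
  ∑pairs-swap f = trans (∑-comm (λ x y → ⟦ x ≠ᵇ y ⟧ * f x y))
    (sum-cong-≗ (λ x → sum-cong-≗ (λ y → cong (λ b → ⟦ b ⟧ * f y x) (≠ᵇ-sym y x))))

  ∑pairs-+ : ∀ f g → ∑pairs (λ x y → f x y + g x y) ≡ ∑pairs f + ∑pairs g
  ∑pairs-+ f g = trans (sum-cong-≗ (λ x → ∑≢-distrib-+ x (f x) (g x)))
                       (∑-distrib-+ (λ x → ∑≢ x (f x)) (λ x → ∑≢ x (g x)))

  ∑pairs-*ˡ : ∀ c f → c * ∑pairs f ≡ ∑pairs (λ x y → c * f x y)
  ∑pairs-*ˡ c f = trans (*-distribˡ-sum c (λ x → ∑≢ x (f x)))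
    (sum-cong-≗ (λ x → trans (*-distribˡ-sum c (λ y → ⟦ x ≠ᵇ y ⟧ * f x y))
                             (sum-cong-≗ (λ y → x∙yz≈y∙xz c ⟦ x ≠ᵇ y ⟧ (f x y)))))

  ∑pairs-const : ∀ c → ∑pairs (λ _ _ → c) ≡ suc M * (M * c)
  ∑pairs-const c = trans (sum-cong-≗ (λ x → ∑≢-const x c)) (sum-const (suc M) (M * c))

  ∑pairs-fst : ∀ (f : Fin (suc M) → ℕ) → ∑pairs (λ x _ → f x) ≡ M * sum f
  ∑pairs-fst f = trans (sum-cong-≗ (λ x → ∑≢-const x (f x))) (sym (*-distribˡ-sum M f))

  load : Fin (suc M) → ℕ
  load x = ∑≢ x (λ z → weight n (deg (col x z) x))

  load-by-colour : ∀ x → load x ≡ sum (λ c → deg c x * weight n (deg c x))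
  load-by-colour x = ∑≢-by-colour x (λ c → weight n (deg c x))

  Window : Fin (suc M) → Set
  Window x = ∀ c → n < deg c x × deg c x ≤ n + n

  module _ (noGood : ∀ x y → ¬ Good n n x y) where

    reach<2n : ∀ {x y} → x ≢ y → n < deg (col x y) x → n < deg (col x y) y → reach x y < n + n
    reach<2n {x} {y} x≢y n<dx n<dy = ≰⇒> (λ 2n≤reach → noGood x y (x≢y , n<dx , n<dy , 2n≤reach))

    weight-edge : ∀ {x y} → x ≢ y → 2 ≤ weight n (deg (col x y) x) + weight n (deg (col x y) y)
    weight-edge {x} {y} x≢y = by-cases (deg (col x y) x ≤? n) (deg (col x y) y ≤? n)
      where
      dx = deg (col x y) x
      dy = deg (col x y) y
      by-cases : Dec (dx ≤ n) → Dec (dy ≤ n) → 2 ≤ weight n dx + weight n dy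
      by-cases (yes dx≤n) _ = subst (λ w → 2 ≤ w + weight n dy) (sym (weight-low n dx≤n)) (m≤m+n 2 _)
      by-cases (no _) (yes dy≤n) = subst (λ w → 2 ≤ weight n dx + w) (sym (weight-low n dy≤n)) (m≤n+m 2 _)
      by-cases (no dx≰n) (no dy≰n) = ≤-reflexive (sym (cong₂ _+_
          (weight-mid n (≰⇒> dx≰n) (≤-trans (degˣ≤reach+1 x≢y) reach+1≤2n))
          (weight-mid n (≰⇒> dy≰n) (≤-trans (degʸ≤reach+1 x≢y) reach+1≤2n))))
        where
        reach+1≤2n : reach x y + 1 ≤ n + n
        reach+1≤2n = subst (_≤ n + n) (+-comm 1 _) (reach<2n x≢y (≰⇒> dx≰n) (≰⇒> dy≰n))

    load-total : suc M * M ≤ sum load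
    load-total = *-cancelˡ-≤ 2 (begin
      2 * (suc M * M)                   ≡⟨ solve (M ∷ []) ⟩
      suc M * (M * 2)                   ≡⟨ ∑pairs-const 2 ⟨
      ∑pairs (λ _ _ → 2)                ≤⟨ ∑pairs-mono two≤ ⟩
      ∑pairs (λ x z → w x z + w z x)    ≡⟨ ∑pairs-+ w (λ x z → w z x) ⟩
      sum load + ∑pairs (λ x z → w z x) ≡⟨ cong (sum load +_) (∑pairs-swap w) ⟨
      sum load + sum load               ≡⟨ cong (sum load +_) (+-identityʳ (sum load)) ⟨
      2 * sum load                      ∎)
      where
      open ≤-Reasoning
      w : Fin (suc M) → Fin (suc M) → ℕ
      w x z = weight n (deg (col x z) x)
      two≤ : ∀ x z → x ≢ z → 2 ≤ w x z + w z x
      two≤ x z x≢z = subst (λ c → 2 ≤ w x z + weight n (deg c z)) (symm χ x z) (weight-edge x≢z)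

    window-load : ∀ {x} → Window x → load x ≡ M
    window-load {x} window = begin
      load x
        ≡⟨ load-by-colour x ⟩
      sum (λ c → deg c x * weight n (deg c x))
        ≡⟨ sum-cong-≗ (λ c → cong (deg c x *_) (weight-mid n (proj₁ (window c)) (proj₂ (window c)))) ⟩
      sum (λ c → deg c x * 1)
        ≡⟨ sum-cong-≗ (λ c → *-identityʳ (deg c x)) ⟩
      sum (λ c → deg c x)
        ≡⟨ deg-sum x ⟩
      M ∎
      where open ≡-Reasoning

    module _ (r2n<M+n : r * (n + n) < M + n) where

      -- A colour of degree > 2n at x gets weight 0, so load x ≤ (r - 1)·2n; a colour of
      -- degree ≤ n with all others ≤ 2n leaves at most r·2n - n < M edges at x.
      window-or-underloaded : ∀ x → Window x ⊎ load x < M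
      window-or-underloaded x with any? (λ c → n + n <? deg c x)
      ... | yes (c₁ , heavy) = inj₂ (+-cancelʳ-< (n + n) (load x) M (begin-strict
            load x + (n + n)  ≡⟨ cong (_+ (n + n)) (load-by-colour x) ⟩
            sum (λ c → deg c x * weight n (deg c x)) + (n + n)
                              ≤⟨ sum-bump-≤ (λ c → deg c x * weight n (deg c x)) c₁ (n + n) (n + n) bound ⟩
            r * (n + n)       <⟨ r2n<M+n ⟩
            M + n             ≤⟨ +-monoʳ-≤ M (m≤m+n n n) ⟩
            M + (n + n)       ∎))
        where
        open ≤-Reasoning
        bound : ∀ c → deg c x * weight n (deg c x) + ⟦ c₁ == c ⟧ * (n + n) ≤ n + n
        bound c with c₁ ≟ c
        ... | yes refl rewrite weight-high n heavy | *-zeroʳ (deg c x) = ≤-reflexive (+-identityʳ (n + n))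
        ... | no _ = subst (_≤ n + n) (sym (+-identityʳ _)) (*-weight≤ n (deg c x))
      ... | no no-heavy with any? (λ c → deg c x ≤? n)
      ...   | yes (c₀ , light) = ⊥-elim (<⇒≱ r2n<M+n (begin
              M + n           ≡⟨ cong (_+ n) (deg-sum x) ⟨
              sum (λ c → deg c x) + n ≤⟨ sum-bump-≤ (λ c → deg c x) c₀ n (n + n) bound ⟩
              r * (n + n)     ∎))
        where
        open ≤-Reasoning
        bound : ∀ c → deg c x + ⟦ c₀ == c ⟧ * n ≤ n + n
        bound c with c₀ ≟ c
        ... | yes refl = +-mono-≤ light (≤-reflexive (+-identityʳ n))
        ... | no _ = subst (_≤ n + n) (sym (+-identityʳ _)) (≮⇒≥ (no-heavy ∘ (c ,_)))
      ...   | no no-light = inj₁ (λ c → ≰⇒> (no-light ∘ (c ,_)) , ≮⇒≥ (no-heavy ∘ (c ,_)))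

      degree-window : ∀ x → Window x
      degree-window x with window-or-underloaded x
      ... | inj₁ window = window
      ... | inj₂ underloaded = ⊥-elim (<⇒≱ (sum-mono-< x load≤M underloaded)
              (≤-trans (≤-reflexive (sum-const (suc M) M)) load-total))
        where
        load≤M : ∀ z → load z ≤ M
        load≤M z with window-or-underloaded z
        ... | inj₁ window = ≤-reflexive (window-load window)
        ... | inj₂ lt = <⇒≤ lt

    module _ (window : ∀ x → Window x) where

      reach+1≤2n : ∀ {x y} → x ≢ y → reach x y + 1 ≤ n + n
      reach+1≤2n {x} {y} x≢y = subst (_≤ n + n) (+-comm 1 _)
        (reach<2n x≢y (proj₁ (window x (col x y))) (proj₁ (window y (col x y))))

      slack : Fin r → Fin (suc M) → ℕ
      slack c x = (n + n) ∸ deg c x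

      onlyʸ same rainbow : Fin (suc M) → Fin (suc M) → Fin (suc M) → Bool
      onlyʸ   x y z = outside x y z ∧ ((col y z == col x y) ∧ not (col x z == col x y))
      same    x y z = outside x y z ∧ ((col x z == col y z) ∧ not (col x z == col x y))
      rainbow x y z = outside x y z ∧ distinct₃ (col x y) (col x z) (col y z)

      reach-split : ∀ x y → reach x y ≡ count (nbrˣ x y) + count (onlyʸ x y)
      reach-split x y = trans (sum-cong-≗ (λ z → ⟦∨⟧-split (outside x y z) (col x z == col x y) (col y z == col x y)))
                              (∑-distrib-+ (λ z → ⟦ nbrˣ x y z ⟧) (λ z → ⟦ onlyʸ x y z ⟧))
        where
        ⟦∨⟧-split : ∀ o p q → ⟦ (o ∧ p) ∨ (o ∧ q) ⟧ ≡ ⟦ o ∧ p ⟧ + ⟦ o ∧ (q ∧ not p) ⟧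
        ⟦∨⟧-split false p     q     = refl
        ⟦∨⟧-split true  true  true  = refl
        ⟦∨⟧-split true  true  false = refl
        ⟦∨⟧-split true  false true  = refl
        ⟦∨⟧-split true  false false = refl

      onlyʸ≤slack : ∀ {x y} → x ≢ y → count (onlyʸ x y) ≤ slack (col x y) x
      onlyʸ≤slack {x} {y} x≢y = m+n≤o⇒m≤o∸n (count (onlyʸ x y)) (begin
        count (onlyʸ x y) + deg (col x y) x
          ≡⟨ cong (count (onlyʸ x y) +_) (count-nbrˣ x≢y) ⟨
        count (onlyʸ x y) + (count (nbrˣ x y) + 1)
          ≡⟨ +-assoc (count (onlyʸ x y)) _ 1 ⟨
        count (onlyʸ x y) + count (nbrˣ x y) + 1
          ≡⟨ cong (_+ 1) (trans (+-comm (count (onlyʸ x y)) (count (nbrˣ x y))) (sym (reach-split x y))) ⟩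
        reach x y + 1
          ≤⟨ reach+1≤2n x≢y ⟩
        n + n ∎)
        where open ≤-Reasoning

      outside-partition : ∀ x y → count (outside x y) ≡ reach x y + count (same x y) + count (rainbow x y)
      outside-partition x y = begin
        count (outside x y)
          ≡⟨ sum-cong-≗ (λ z → partition (outside x y z) (col x z == col x y) (col y z == col x y)
                                 (col x z == col y z) (transitive z)) ⟩
        sum (λ z → ⟦ nbrˣ x y z ∨ nbrʸ x y z ⟧ + ⟦ same x y z ⟧ + ⟦ rainbow x y z ⟧)
          ≡⟨ ∑-distrib-+ (λ z → ⟦ nbrˣ x y z ∨ nbrʸ x y z ⟧ + ⟦ same x y z ⟧) (λ z → ⟦ rainbow x y z ⟧) ⟩
        sum (λ z → ⟦ nbrˣ x y z ∨ nbrʸ x y z ⟧ + ⟦ same x y z ⟧) + count (rainbow x y)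
          ≡⟨ cong (_+ count (rainbow x y)) (∑-distrib-+ (λ z → ⟦ nbrˣ x y z ∨ nbrʸ x y z ⟧) (λ z → ⟦ same x y z ⟧)) ⟩
        reach x y + count (same x y) + count (rainbow x y) ∎
        where
        open ≡-Reasoning
        transitive : ∀ z → (col y z == col x y) ≡ true → (col x z == col y z) ≡ true → (col x z == col x y) ≡ true
        transitive z yz≡a xz≡yz = ≡⇒== (trans (==⇒≡ {a = col x z} xz≡yz) (==⇒≡ {a = col y z} yz≡a))
        partition : ∀ o p q s → (q ≡ true → s ≡ true → p ≡ true) →
          ⟦ o ⟧ ≡ ⟦ (o ∧ p) ∨ (o ∧ q) ⟧ + ⟦ o ∧ (s ∧ not p) ⟧ + ⟦ o ∧ (not p ∧ not q ∧ not s) ⟧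
        partition false _     _     _     _ = refl
        partition true  true  true  true  _ = refl
        partition true  true  true  false _ = refl
        partition true  true  false true  _ = refl
        partition true  true  false false _ = refl
        partition true  false true  true  q∧s⇒p with q∧s⇒p refl refl
        ... | ()
        partition true  false true  false _ = refl
        partition true  false false true  _ = refl
        partition true  false false false _ = refl

      M≤rainbow+same+2n : ∀ {x y} → x ≢ y → M ≤ count (rainbow x y) + count (same x y) + (n + n)
      M≤rainbow+same+2n {x} {y} x≢y = +-cancelʳ-≤ 1 M _ (begin
        M + 1
          ≡⟨ +-comm M 1 ⟩
        suc M
          ≡⟨ count-≢₂ x≢y ⟨
        count (outside x y) + 1 + 1
          ≡⟨ cong (λ o → o + 1 + 1) (outside-partition x y) ⟩
        reach x y + count (same x y) + count (rainbow x y) + 1 + 1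
          ≡⟨ shuffle₁ (reach x y) (count (same x y)) (count (rainbow x y)) ⟩
        count (rainbow x y) + count (same x y) + 1 + (reach x y + 1)
          ≤⟨ +-monoʳ-≤ (count (rainbow x y) + count (same x y) + 1) (reach+1≤2n x≢y) ⟩
        count (rainbow x y) + count (same x y) + 1 + (n + n)
          ≡⟨ shuffle₂ (count (rainbow x y)) (count (same x y)) (n + n) ⟩
        count (rainbow x y) + count (same x y) + (n + n) + 1 ∎)
        where
        open ≤-Reasoning
        shuffle₁ : ∀ a b c → a + b + c + 1 + 1 ≡ c + b + 1 + (a + 1)
        shuffle₁ = solve-∀
        shuffle₂ : ∀ a b c → a + b + 1 + c ≡ a + b + c + 1
        shuffle₂ = solve-∀

      totalSlack : Fin (suc M) → ℕ
      totalSlack x = ∑≢ x (λ z → slack (col x z) x)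

      -- z is seen by x and y in one colour other than col x y exactly when y is
      -- joined to z, but not to x, in the colour of xz.
      same≤totalSlack : ∀ x → ∑≢ x (λ y → count (same x y)) ≤ totalSlack x
      same≤totalSlack x = begin
        ∑≢ x (λ y → count (same x y))
          ≡⟨ sum-cong-≗ (λ y → *-distribˡ-sum ⟦ x ≠ᵇ y ⟧ (λ z → ⟦ same x y z ⟧)) ⟩
        sum (λ y → sum (λ z → ⟦ x ≠ᵇ y ⟧ * ⟦ same x y z ⟧))
          ≡⟨ ∑-comm (λ y z → ⟦ x ≠ᵇ y ⟧ * ⟦ same x y z ⟧) ⟩
        sum (λ z → sum (λ y → ⟦ x ≠ᵇ y ⟧ * ⟦ same x y z ⟧))
          ≡⟨ sum-cong-≗ (λ z → sum-cong-≗ (λ y → same≡onlyʸ y z)) ⟩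
        sum (λ z → sum (λ y → ⟦ x ≠ᵇ z ⟧ * ⟦ onlyʸ x z y ⟧))
          ≡⟨ sum-cong-≗ (λ z → *-distribˡ-sum ⟦ x ≠ᵇ z ⟧ (λ y → ⟦ onlyʸ x z y ⟧)) ⟨
        ∑≢ x (λ z → count (onlyʸ x z))
          ≤⟨ sum-mono-≤ (λ z → ⟦⟧*-mono (x ≠ᵇ z) (λ x≠z → onlyʸ≤slack (not-==⇒≢ {a = x} {b = z} x≠z))) ⟩
        totalSlack x ∎
        where
        open ≤-Reasoning
        swap : ∀ p q r u → ⟦ p ⟧ * ⟦ (q ∧ r) ∧ u ⟧ ≡ ⟦ q ⟧ * ⟦ (p ∧ r) ∧ u ⟧
        swap false false _ _ = refl
        swap false true  _ _ = refl
        swap true  false _ _ = refl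
        swap true  true  _ _ = refl
        same≡onlyʸ : ∀ y z → ⟦ x ≠ᵇ y ⟧ * ⟦ same x y z ⟧ ≡ ⟦ x ≠ᵇ z ⟧ * ⟦ onlyʸ x z y ⟧
        same≡onlyʸ y z
          rewrite ≠ᵇ-sym z y | symm χ z y | ==-sym (col y z) (col x z) | ==-sym (col x y) (col x z)
          = swap (x ≠ᵇ y) (x ≠ᵇ z) (y ≠ᵇ z) ((col x z == col y z) ∧ not (col x z == col x y))

      rainbowPairs : ℕ
      rainbowPairs = sum (λ x → ∑≢ x (λ y → count (rainbow x y)))

      slackSum : ℕ
      slackSum = sum totalSlack

      M²≤rainbow+slack : ∀ x → M * M ≤ ∑≢ x (λ y → count (rainbow x y)) + totalSlack x + M * (n + n)
      M²≤rainbow+slack x = begin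
        M * M
          ≡⟨ ∑≢-const x M ⟨
        ∑≢ x (λ _ → M)
          ≤⟨ sum-mono-≤ (λ y → ⟦⟧*-mono (x ≠ᵇ y) (λ x≠y → M≤rainbow+same+2n (not-==⇒≢ {a = x} {b = y} x≠y))) ⟩
        ∑≢ x (λ y → F y + S y + (n + n))
          ≡⟨ ∑≢-distrib-+ x (λ y → F y + S y) (λ _ → n + n) ⟩
        ∑≢ x (λ y → F y + S y) + ∑≢ x (λ _ → n + n)
          ≡⟨ cong₂ _+_ (∑≢-distrib-+ x F S) (∑≢-const x (n + n)) ⟩
        ∑≢ x F + ∑≢ x S + M * (n + n)
          ≤⟨ +-monoˡ-≤ (M * (n + n)) (+-monoʳ-≤ (∑≢ x F) (same≤totalSlack x)) ⟩
        ∑≢ x F + totalSlack x + M * (n + n) ∎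
        where
        open ≤-Reasoning
        F S : Fin (suc M) → ℕ
        F y = count (rainbow x y)
        S y = count (same x y)

      rainbowPairs+slackSum-bound : suc M * (M * M) ≤ rainbowPairs + slackSum + suc M * (M * (n + n))
      rainbowPairs+slackSum-bound = begin
        suc M * (M * M)
          ≡⟨ sum-const (suc M) (M * M) ⟨
        sum {suc M} (λ _ → M * M)
          ≤⟨ sum-mono-≤ M²≤rainbow+slack ⟩
        sum (λ x → ∑≢ x (F x) + totalSlack x + M * (n + n))
          ≡⟨ ∑-distrib-+ (λ x → ∑≢ x (F x) + totalSlack x) (λ _ → M * (n + n)) ⟩
        sum (λ x → ∑≢ x (F x) + totalSlack x) + sum {suc M} (λ _ → M * (n + n))
          ≡⟨ cong₂ _+_ (∑-distrib-+ (λ x → ∑≢ x (F x)) totalSlack) (sum-const (suc M) (M * (n + n))) ⟩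
        rainbowPairs + slackSum + suc M * (M * (n + n)) ∎
        where
        open ≤-Reasoning
        F : Fin (suc M) → Fin (suc M) → ℕ
        F x y = count (rainbow x y)

      totalSlack+∑deg² : ∀ x → totalSlack x + sum (λ c → deg c x * deg c x) ≡ M * (n + n)
      totalSlack+∑deg² x = begin
        totalSlack x + sum (λ c → deg c x * deg c x)
          ≡⟨ cong (_+ _) (∑≢-by-colour x (λ c → slack c x)) ⟩
        sum (λ c → deg c x * slack c x) + sum (λ c → deg c x * deg c x)
          ≡⟨ ∑-distrib-+ (λ c → deg c x * slack c x) (λ c → deg c x * deg c x) ⟨
        sum (λ c → deg c x * slack c x + deg c x * deg c x)
          ≡⟨ sum-cong-≗ (λ c → trans (sym (*-distribˡ-+ (deg c x) (slack c x) (deg c x)))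
                                     (cong (deg c x *_) (m∸n+n≡m (proj₂ (window x c))))) ⟩
        sum (λ c → deg c x * (n + n))
          ≡⟨ *-distribʳ-sum (n + n) (λ c → deg c x) ⟨
        sum (λ c → deg c x) * (n + n)
          ≡⟨ cong (_* (n + n)) (deg-sum x) ⟩
        M * (n + n) ∎
        where open ≡-Reasoning

      -- As totalSlack x + ∑_c (deg c x)² = M·2n, this is Cauchy–Schwarz M² ≤ r ∑_c (deg c x)².
      totalSlack-bound : ∀ x → r * totalSlack x + M * M ≤ r * (M * (n + n))
      totalSlack-bound x = begin
        r * totalSlack x + M * M                       ≡⟨ cong (λ d → r * totalSlack x + d * d) (deg-sum x) ⟨
        r * totalSlack x + sum degs * sum degs         ≤⟨ +-monoʳ-≤ (r * totalSlack x) (sum-sq≤ degs) ⟩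
        r * totalSlack x + r * sum (λ c → degs c * degs c) ≡⟨ *-distribˡ-+ r (totalSlack x) _ ⟨
        r * (totalSlack x + sum (λ c → degs c * degs c))  ≡⟨ cong (r *_) (totalSlack+∑deg² x) ⟩
        r * (M * (n + n))                              ∎
        where
        open ≤-Reasoning
        degs : Fin r → ℕ
        degs c = deg c x

      slackSum-bound : r * slackSum + suc M * (M * M) ≤ suc M * (r * (M * (n + n)))
      slackSum-bound = begin
        r * slackSum + suc M * (M * M)
          ≡⟨ cong₂ _+_ (*-distribˡ-sum r totalSlack) (sym (sum-const (suc M) (M * M))) ⟩
        sum (λ x → r * totalSlack x) + sum {suc M} (λ _ → M * M)
          ≡⟨ ∑-distrib-+ (λ x → r * totalSlack x) (λ _ → M * M) ⟨
        sum (λ x → r * totalSlack x + M * M)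
          ≤⟨ sum-mono-≤ totalSlack-bound ⟩
        sum {suc M} (λ _ → r * (M * (n + n)))
          ≡⟨ sum-const (suc M) _ ⟩
        suc M * (r * (M * (n + n))) ∎
        where open ≤-Reasoning

      class : Fin (suc M) → Fin (suc M) → Fin r → Fin r → Fin (suc M) → Bool
      class x y b e z = outside x y z ∧ ((col x z == b) ∧ (col y z == e))

      classSize : Fin (suc M) → Fin (suc M) → Fin r → Fin r → ℕ
      classSize x y b e = count (class x y b e)

      sum-over-rainbow : ∀ x y (h : Fin r → Fin r → ℕ) →
        sum (λ z → ⟦ rainbow x y z ⟧ * h (col x z) (col y z)) ≡
        sum (λ b → sum (λ e → ⟦ distinct₃ (col x y) b e ⟧ * (classSize x y b e * h b e)))
      sum-over-rainbow x y h = begin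
        sum (λ z → ⟦ rainbow x y z ⟧ * h (col x z) (col y z))
          ≡⟨ sum-cong-≗ (λ z → trans (cong (_* h (col x z) (col y z)) (⟦∧⟧ (outside x y z) (distinct₃ (col x y) (col x z) (col y z))))
                                      (*-assoc ⟦ outside x y z ⟧ (D (col x z) (col y z)) (h (col x z) (col y z)))) ⟩
        sum (λ z → g z (col x z) (col y z))
          ≡⟨ sum-fibres (col x) (λ z b → g z b (col y z)) ⟩
        sum (λ b → sum (λ z → ⟦ col x z == b ⟧ * g z b (col y z)))
          ≡⟨ sum-cong-≗ (λ b → sum-fibres (col y) (λ z e → ⟦ col x z == b ⟧ * g z b e)) ⟩
        sum (λ b → sum (λ e → sum (λ z → ⟦ col y z == e ⟧ * (⟦ col x z == b ⟧ * g z b e))))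
          ≡⟨ sum-cong-≗ (λ b → sum-cong-≗ (λ e → fibre b e)) ⟩
        sum (λ b → sum (λ e → D b e * (classSize x y b e * h b e))) ∎
        where
        open ≡-Reasoning
        D : Fin r → Fin r → ℕ
        D b e = ⟦ distinct₃ (col x y) b e ⟧
        g : Fin (suc M) → Fin r → Fin r → ℕ
        g z b e = ⟦ outside x y z ⟧ * (D b e * h b e)
        shuffle : ∀ u v o w → u * (v * (o * w)) ≡ o * (v * u) * w
        shuffle = solve-∀
        fibre : ∀ b e → sum (λ z → ⟦ col y z == e ⟧ * (⟦ col x z == b ⟧ * g z b e)) ≡
                        D b e * (classSize x y b e * h b e)
        fibre b e = begin
          sum (λ z → ⟦ col y z == e ⟧ * (⟦ col x z == b ⟧ * g z b e))
            ≡⟨ sum-cong-≗ (λ z → trans (shuffle ⟦ col y z == e ⟧ ⟦ col x z == b ⟧ ⟦ outside x y z ⟧ w)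
                                        (cong (_* w) (class-indicator z))) ⟩
          sum (λ z → ⟦ class x y b e z ⟧ * w)
            ≡⟨ *-distribʳ-sum w (λ z → ⟦ class x y b e z ⟧) ⟨
          classSize x y b e * w
            ≡⟨ x∙yz≈y∙xz (classSize x y b e) (D b e) (h b e) ⟩
          D b e * (classSize x y b e * h b e) ∎
          where
          w = D b e * h b e
          class-indicator : ∀ z → ⟦ outside x y z ⟧ * (⟦ col x z == b ⟧ * ⟦ col y z == e ⟧) ≡ ⟦ class x y b e z ⟧
          class-indicator z = sym (trans (⟦∧⟧ (outside x y z) ((col x z == b) ∧ (col y z == e)))
                                         (cong (⟦ outside x y z ⟧ *_) (⟦∧⟧ (col x z == b) (col y z == e))))

      colourPairs : ℕ
      colourPairs = (r ∸ 1) * (r ∸ 2)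

      classSq : Fin (suc M) → Fin (suc M) → ℕ
      classSq x y = sum (λ z → ⟦ rainbow x y z ⟧ * classSize x y (col x z) (col y z))

      rainbow-by-classes : ∀ x y →
        count (rainbow x y) ≡ ∑∑ (λ b e → ⟦ distinct₃ (col x y) b e ⟧ * (classSize x y b e * 1))
      rainbow-by-classes x y =
        trans (sum-cong-≗ (λ z → sym (*-identityʳ ⟦ rainbow x y z ⟧))) (sum-over-rainbow x y (λ _ _ → 1))

      rainbow≤ : ∀ x y → count (rainbow x y) ≤ suc M * colourPairs
      rainbow≤ x y = begin
        count (rainbow x y)
          ≡⟨ rainbow-by-classes x y ⟩
        ∑∑ (λ b e → D b e * (classSize x y b e * 1)) ≤⟨ ∑∑-mono (λ b e → *-monoʳ-≤ (D b e)
                                                        (≤-trans (≤-reflexive (*-identityʳ _)) (count≤ (class x y b e)))) ⟩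
        ∑∑ (λ b e → D b e * suc M)
          ≡⟨ ∑∑-*ʳ (suc M) D ⟨
        ∑∑ D * suc M
          ≡⟨ cong (_* suc M) (count-distinct₃ (col x y)) ⟩
        colourPairs * suc M
          ≡⟨ *-comm colourPairs (suc M) ⟩
        suc M * colourPairs ∎
        where
        open ≤-Reasoning
        D : Fin r → Fin r → ℕ
        D b e = ⟦ distinct₃ (col x y) b e ⟧

      -- Cauchy–Schwarz over the V = colourPairs classes, linearised by AM–GM as
      -- 2·(V·Y)·A ≤ (V·Y)² + A².
      rainbow-am-gm-scaled : ∀ x y A →
        colourPairs * (2 * A * count (rainbow x y)) ≤ colourPairs * (colourPairs * classSq x y + A * A)
      rainbow-am-gm-scaled x y A = begin
        V * (2 * A * count (rainbow x y))
          ≡⟨ cong (λ f → V * (2 * A * f)) (rainbow-by-classes x y) ⟩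
        V * (2 * A * ∑∑ (λ b e → D b e * (Y b e * 1)))
          ≡⟨ cong (V *_) (∑∑-*ˡ (2 * A) (λ b e → D b e * (Y b e * 1))) ⟩
        V * ∑∑ (λ b e → 2 * A * (D b e * (Y b e * 1)))
          ≡⟨ ∑∑-*ˡ V (λ b e → 2 * A * (D b e * (Y b e * 1))) ⟩
        ∑∑ (λ b e → V * (2 * A * (D b e * (Y b e * 1))))
          ≡⟨ ∑∑-cong (λ b e → lhs V A (D b e) (Y b e)) ⟩
        ∑∑ (λ b e → D b e * (2 * (V * Y b e * A)))
          ≤⟨ ∑∑-mono (λ b e → *-monoʳ-≤ (D b e) (am-gm (V * Y b e) A)) ⟩
        ∑∑ (λ b e → D b e * (V * Y b e * (V * Y b e) + A * A))
          ≡⟨ ∑∑-cong (λ b e → rhs V A (D b e) (Y b e)) ⟩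
        ∑∑ (λ b e → V * V * (D b e * (Y b e * Y b e)) + A * A * D b e)
          ≡⟨ ∑∑-+ (λ b e → V * V * (D b e * (Y b e * Y b e))) (λ b e → A * A * D b e) ⟩
        ∑∑ (λ b e → V * V * (D b e * (Y b e * Y b e))) + ∑∑ (λ b e → A * A * D b e)
          ≡⟨ cong₂ _+_ (∑∑-*ˡ (V * V) (λ b e → D b e * (Y b e * Y b e))) (∑∑-*ˡ (A * A) D) ⟨
        V * V * ∑∑ (λ b e → D b e * (Y b e * Y b e)) + A * A * ∑∑ D
          ≡⟨ cong₂ (λ z v → V * V * z + A * A * v) (sum-over-rainbow x y Y) (sym (count-distinct₃ (col x y))) ⟨
        V * V * classSq x y + A * A * V
          ≡⟨ factor V (classSq x y) A ⟩
        V * (V * classSq x y + A * A) ∎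
        where
        open ≤-Reasoning
        V = colourPairs
        D : Fin r → Fin r → ℕ
        D b e = ⟦ distinct₃ (col x y) b e ⟧
        Y = classSize x y
        lhs : ∀ V A d y → V * (2 * A * (d * (y * 1))) ≡ d * (2 * (V * y * A))
        lhs = solve-∀
        rhs : ∀ V A d y → d * (V * y * (V * y) + A * A) ≡ V * V * (d * (y * y)) + A * A * d
        rhs = solve-∀
        factor : ∀ V z A → V * V * z + A * A * V ≡ V * (V * z + A * A)
        factor = solve-∀

      rainbow-am-gm : ∀ x y A → 2 * A * count (rainbow x y) ≤ colourPairs * classSq x y + A * A
      rainbow-am-gm x y A = *-cancelˡ-≤′ colourPairs (rainbow-am-gm-scaled x y A) no-colourPairs
        where
        no-colourPairs : colourPairs ≡ 0 → 2 * A * count (rainbow x y) ≡ 0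
        no-colourPairs V≡0 = trans (cong (2 * A *_) (n≤0⇒n≡0
          (subst (count (rainbow x y) ≤_) (trans (cong (suc M *_) V≡0) (*-zeroʳ (suc M))) (rainbow≤ x y))))
          (*-zeroʳ (2 * A))

      rainbow⇒ : ∀ {x y z} → rainbow x y z ≡ true → x ≢ z × y ≢ z × col x z ≢ col y z
      rainbow⇒ {x} {y} {z} z-rainbow =
        not-==⇒≢ (proj₁ (∧-true z∉xy)) , not-==⇒≢ (proj₂ (∧-true {x ≠ᵇ z} z∉xy)) ,
        not-==⇒≢ (proj₂ (∧-true {not (col y z == col x y)}
                   (proj₂ (∧-true {not (col x z == col x y)} distinct))))
        where
        z∉xy : outside x y z ≡ true
        z∉xy = proj₁ (∧-true z-rainbow)
        distinct : distinct₃ (col x y) (col x z) (col y z) ≡ true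
        distinct = proj₂ (∧-true {outside x y z} z-rainbow)

      -- A point w ≠ z of the class of z is joined to x in the colour of xz and to y in
      -- the colour of yz; as these differ, so does the colour of zw from one of them.
      class-cover : ∀ {x y z w} → col x z ≢ col y z → class x y (col x z) (col y z) w ≡ true →
        (z == w) ≡ true ⊎ onlyʸ z x w ≡ true ⊎ onlyʸ z y w ≡ true
      class-cover {x} {y} {z} {w} xz≢yz w∈class = by-cases (z ≟ w) (col z w ≟ col z x)
        where
        w∉xy : outside x y w ≡ true
        w∉xy = proj₁ (∧-true w∈class)
        w-colours : ((col x w == col x z) ∧ (col y w == col y z)) ≡ true
        w-colours = proj₂ (∧-true {outside x y w} w∈class)
        xw≡xz : col x w ≡ col x z
        xw≡xz = ==⇒≡ (proj₁ (∧-true w-colours))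
        yw≡yz : col y w ≡ col y z
        yw≡yz = ==⇒≡ (proj₂ (∧-true {col x w == col x z} w-colours))
        by-cases : Dec (z ≡ w) → Dec (col z w ≡ col z x) →
          (z == w) ≡ true ⊎ onlyʸ z x w ≡ true ⊎ onlyʸ z y w ≡ true
        by-cases (yes z≡w) _ = inj₁ (≡⇒== z≡w)
        by-cases (no z≢w) (no zw≢zx) = inj₂ (inj₁
          (∧-intro (∧-intro (≢⇒not-== z≢w) (proj₁ (∧-true w∉xy)))
                   (∧-intro (≡⇒== (trans xw≡xz (symm χ x z))) (not-intro (≢⇒== zw≢zx)))))
        by-cases (no z≢w) (yes zw≡zx) = inj₂ (inj₂
          (∧-intro (∧-intro (≢⇒not-== z≢w) (proj₂ (∧-true {x ≠ᵇ w} w∉xy)))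
                   (∧-intro (≡⇒== (trans yw≡yz (symm χ y z))) (not-intro (≢⇒== zw≢zy)))))
          where
          zw≢zy : col z w ≢ col z y
          zw≢zy zw≡zy = xz≢yz (trans (symm χ x z) (trans (sym zw≡zx) (trans zw≡zy (symm χ z y))))

      class-bound : ∀ {x y z} → rainbow x y z ≡ true →
        classSize x y (col x z) (col y z) ≤ 1 + slack (col x z) z + slack (col y z) z
      class-bound {x} {y} {z} z-rainbow with rainbow⇒ z-rainbow
      ... | x≢z , y≢z , xz≢yz = begin
        classSize x y (col x z) (col y z)
          ≤⟨ sum-mono-≤ (λ w → ⟦⟧≤-cover₃ (class-cover {x} {y} {z} {w} xz≢yz)) ⟩
        sum (λ w → ⟦ z == w ⟧ + ⟦ onlyʸ z x w ⟧ + ⟦ onlyʸ z y w ⟧)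
          ≡⟨ ∑-distrib-+ (λ w → ⟦ z == w ⟧ + ⟦ onlyʸ z x w ⟧) (λ w → ⟦ onlyʸ z y w ⟧) ⟩
        sum (λ w → ⟦ z == w ⟧ + ⟦ onlyʸ z x w ⟧) + count (onlyʸ z y)
          ≡⟨ cong (_+ count (onlyʸ z y)) (∑-distrib-+ (λ w → ⟦ z == w ⟧) (λ w → ⟦ onlyʸ z x w ⟧)) ⟩
        count (z ==_) + count (onlyʸ z x) + count (onlyʸ z y)
          ≤⟨ +-mono-≤ (+-mono-≤ (≤-reflexive (count-== z)) (onlyʸ≤slack {z} {x} (x≢z ∘ sym)))
                      (onlyʸ≤slack {z} {y} (y≢z ∘ sym)) ⟩
        1 + slack (col z x) z + slack (col z y) z
          ≡⟨ cong₂ (λ a b → 1 + slack a z + slack b z) (symm χ z x) (symm χ z y) ⟩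
        1 + slack (col x z) z + slack (col y z) z ∎
        where open ≤-Reasoning

      farSlack : Fin (suc M) → ℕ
      farSlack x = ∑≢ x (λ z → slack (col x z) z)

      classSq≤ : ∀ x y → classSq x y ≤ count (rainbow x y) + (farSlack x + farSlack y)
      classSq≤ x y = begin
        classSq x y
          ≤⟨ sum-mono-≤ (λ z → ⟦⟧*-mono (rainbow x y z) (class-bound {x} {y} {z})) ⟩
        sum (λ z → ⟦ rainbow x y z ⟧ * (1 + sˣ z + sʸ z))
          ≤⟨ sum-mono-≤ pointwise ⟩
        sum (λ z → ⟦ rainbow x y z ⟧ + (⟦ x ≠ᵇ z ⟧ * sˣ z + ⟦ y ≠ᵇ z ⟧ * sʸ z))
          ≡⟨ ∑-distrib-+ (λ z → ⟦ rainbow x y z ⟧) (λ z → ⟦ x ≠ᵇ z ⟧ * sˣ z + ⟦ y ≠ᵇ z ⟧ * sʸ z) ⟩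
        count (rainbow x y) + sum (λ z → ⟦ x ≠ᵇ z ⟧ * sˣ z + ⟦ y ≠ᵇ z ⟧ * sʸ z)
          ≡⟨ cong (count (rainbow x y) +_) (∑-distrib-+ (λ z → ⟦ x ≠ᵇ z ⟧ * sˣ z) (λ z → ⟦ y ≠ᵇ z ⟧ * sʸ z)) ⟩
        count (rainbow x y) + (farSlack x + farSlack y) ∎
        where
        open ≤-Reasoning
        sˣ sʸ : Fin (suc M) → ℕ
        sˣ z = slack (col x z) z
        sʸ z = slack (col y z) z
        expand : ∀ b s t → b * (1 + s + t) ≡ b + (b * s + b * t)
        expand = solve-∀
        rainbow≤ˣ : ∀ z → ⟦ rainbow x y z ⟧ ≤ ⟦ x ≠ᵇ z ⟧
        rainbow≤ˣ z = ≤-trans (⟦∧⟧≤ˡ (outside x y z) _) (⟦∧⟧≤ˡ (x ≠ᵇ z) (y ≠ᵇ z))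
        rainbow≤ʸ : ∀ z → ⟦ rainbow x y z ⟧ ≤ ⟦ y ≠ᵇ z ⟧
        rainbow≤ʸ z = ≤-trans (⟦∧⟧≤ˡ (outside x y z) _) (⟦∧⟧≤ʳ (x ≠ᵇ z) (y ≠ᵇ z))
        pointwise : ∀ z → ⟦ rainbow x y z ⟧ * (1 + sˣ z + sʸ z) ≤
                          ⟦ rainbow x y z ⟧ + (⟦ x ≠ᵇ z ⟧ * sˣ z + ⟦ y ≠ᵇ z ⟧ * sʸ z)
        pointwise z = begin
          ⟦ rainbow x y z ⟧ * (1 + sˣ z + sʸ z)
            ≡⟨ expand ⟦ rainbow x y z ⟧ (sˣ z) (sʸ z) ⟩
          ⟦ rainbow x y z ⟧ + (⟦ rainbow x y z ⟧ * sˣ z + ⟦ rainbow x y z ⟧ * sʸ z)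
            ≤⟨ +-monoʳ-≤ ⟦ rainbow x y z ⟧ (+-mono-≤ (*-monoˡ-≤ (sˣ z) (rainbow≤ˣ z)) (*-monoˡ-≤ (sʸ z) (rainbow≤ʸ z))) ⟩
          ⟦ rainbow x y z ⟧ + (⟦ x ≠ᵇ z ⟧ * sˣ z + ⟦ y ≠ᵇ z ⟧ * sʸ z) ∎

      classPairs : ℕ
      classPairs = ∑pairs classSq

      classPairs-bound : classPairs ≤ rainbowPairs + (M * slackSum + M * slackSum)
      classPairs-bound = begin
        classPairs
          ≤⟨ ∑pairs-mono (λ x y _ → classSq≤ x y) ⟩
        ∑pairs (λ x y → count (rainbow x y) + (farSlack x + farSlack y))
          ≡⟨ ∑pairs-+ (λ x y → count (rainbow x y)) (λ x y → farSlack x + farSlack y) ⟩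
        rainbowPairs + ∑pairs (λ x y → farSlack x + farSlack y)
          ≡⟨ cong (rainbowPairs +_) (∑pairs-+ (λ x _ → farSlack x) (λ _ y → farSlack y)) ⟩
        rainbowPairs + (∑pairs (λ x _ → farSlack x) + ∑pairs (λ _ y → farSlack y))
          ≡⟨ cong (λ s → rainbowPairs + (∑pairs (λ x _ → farSlack x) + s)) (∑pairs-swap (λ _ y → farSlack y)) ⟩
        rainbowPairs + (∑pairs (λ x _ → farSlack x) + ∑pairs (λ x _ → farSlack x))
          ≡⟨ cong (λ s → rainbowPairs + (s + s)) (trans (∑pairs-fst farSlack) (cong (M *_) farSlack≡)) ⟩
        rainbowPairs + (M * slackSum + M * slackSum) ∎
        where
        open ≤-Reasoning
        farSlack≡ : sum farSlack ≡ slackSum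
        farSlack≡ = trans (∑pairs-swap (λ x z → slack (col x z) z))
          (sum-cong-≗ (λ x → sum-cong-≗ (λ z → cong (λ c → ⟦ x ≠ᵇ z ⟧ * slack c x) (symm χ z x))))

      rainbowPairs-am-gm : ∀ A → 2 * A * rainbowPairs ≤ colourPairs * classPairs + A * A * (suc M * M)
      rainbowPairs-am-gm A = begin
        2 * A * rainbowPairs
          ≡⟨ ∑pairs-*ˡ (2 * A) (λ x y → count (rainbow x y)) ⟩
        ∑pairs (λ x y → 2 * A * count (rainbow x y))
          ≤⟨ ∑pairs-mono (λ x y _ → rainbow-am-gm x y A) ⟩
        ∑pairs (λ x y → colourPairs * classSq x y + A * A)
          ≡⟨ ∑pairs-+ (λ x y → colourPairs * classSq x y) (λ _ _ → A * A) ⟩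
        ∑pairs (λ x y → colourPairs * classSq x y) + ∑pairs (λ _ _ → A * A)
          ≡⟨ cong₂ _+_ (∑pairs-*ˡ colourPairs classSq) (sym (∑pairs-const (A * A))) ⟨
        colourPairs * classPairs + suc M * (M * (A * A))
          ≡⟨ cong (colourPairs * classPairs +_) (solve-∀′ (suc M) M (A * A)) ⟩
        colourPairs * classPairs + A * A * (suc M * M) ∎
        where
        open ≤-Reasoning
        solve-∀′ : ∀ N M a → N * (M * a) ≡ a * (N * M)
        solve-∀′ = solve-∀

-- The four counting inequalities in the totals XF, XW, XZ of rainbow points, slack and
-- class sizes over the N·M ordered pairs; eliminating the totals leaves one inequality.
module _ {r n M A V m c : ℕ} (M≡A+2n : M ≡ A + (n + n)) (r2n≡M+m : r * (n + n) ≡ M + m)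
         (2A≡c+V : 2 * A ≡ c + V) where

  ramsey-inequalities⇒ : ∀ {N XF XW XZ} → 0 < N * M →
    N * (M * M) ≤ XF + XW + N * (M * (n + n)) →
    2 * A * XF ≤ V * XZ + A * A * (N * M) →
    XZ ≤ XF + (M * XW + M * XW) →
    r * XW + N * (M * M) ≤ N * (r * (M * (n + n))) →
    r * c * A ≤ (2 * V * M + c) * m + r * (A * A)
  ramsey-inequalities⇒ {N} {XF} {XW} {XZ} NM>0 I₁ I₂ I₃ I₄ = *-cancelˡ-≤ (N * M) {{>-nonZero NM>0}} (begin
    N * M * (r * c * A)                                     ≡⟨ solve (N ∷ M ∷ r ∷ c ∷ A ∷ []) ⟩
    r * (c * (N * M * A))                                   ≤⟨ *-monoʳ-≤ r cNMA≤ ⟩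
    r * ((2 * V * M + c) * XW + A * A * (N * M))            ≡⟨ solve (N ∷ M ∷ r ∷ V ∷ c ∷ A ∷ XW ∷ []) ⟩
    (2 * V * M + c) * (r * XW) + N * M * (r * (A * A))      ≤⟨ +-monoˡ-≤ _ (*-monoʳ-≤ (2 * V * M + c) rXW≤NMm) ⟩
    (2 * V * M + c) * (N * M * m) + N * M * (r * (A * A))   ≡⟨ solve (N ∷ M ∷ r ∷ V ∷ c ∷ A ∷ m ∷ []) ⟩
    N * M * ((2 * V * M + c) * m + r * (A * A))             ∎)
    where
    open ≤-Reasoning
    NMA≤ : N * M * A ≤ XF + XW
    NMA≤ = +-cancelʳ-≤ (N * M * (n + n)) _ _ (begin
      N * M * A + N * M * (n + n)       ≡⟨ *-distribˡ-+ (N * M) A (n + n) ⟨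
      N * M * (A + (n + n))             ≡⟨ cong (N * M *_) M≡A+2n ⟨
      N * M * M                         ≡⟨ *-assoc N M M ⟩
      N * (M * M)                       ≤⟨ I₁ ⟩
      XF + XW + N * (M * (n + n))       ≡⟨ cong (XF + XW +_) (*-assoc N M (n + n)) ⟨
      XF + XW + N * M * (n + n)         ∎)
    cXF≤ : c * XF ≤ 2 * V * M * XW + A * A * (N * M)
    cXF≤ = +-cancelˡ-≤ (V * XF) _ _ (begin
      V * XF + c * XF                                 ≡⟨ *-distribʳ-+ XF V c ⟨
      (V + c) * XF                                    ≡⟨ cong (_* XF) (trans (+-comm V c) (sym 2A≡c+V)) ⟩
      2 * A * XF                                      ≤⟨ I₂ ⟩
      V * XZ + A * A * (N * M)                        ≤⟨ +-monoˡ-≤ _ (*-monoʳ-≤ V I₃) ⟩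
      V * (XF + (M * XW + M * XW)) + A * A * (N * M)  ≡⟨ solve (V ∷ XF ∷ M ∷ XW ∷ A ∷ N ∷ []) ⟩
      V * XF + (2 * V * M * XW + A * A * (N * M))     ∎)
    cNMA≤ : c * (N * M * A) ≤ (2 * V * M + c) * XW + A * A * (N * M)
    cNMA≤ = begin
      c * (N * M * A)                            ≤⟨ *-monoʳ-≤ c NMA≤ ⟩
      c * (XF + XW)                              ≡⟨ *-distribˡ-+ c XF XW ⟩
      c * XF + c * XW                            ≤⟨ +-monoˡ-≤ _ cXF≤ ⟩
      2 * V * M * XW + A * A * (N * M) + c * XW  ≡⟨ solve (V ∷ M ∷ XW ∷ A ∷ N ∷ c ∷ []) ⟩
      (2 * V * M + c) * XW + A * A * (N * M)     ∎
    rXW≤NMm : r * XW ≤ N * M * m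
    rXW≤NMm = +-cancelʳ-≤ (N * M * M) _ _ (begin
      r * XW + N * M * M          ≡⟨ cong (r * XW +_) (*-assoc N M M) ⟩
      r * XW + N * (M * M)        ≤⟨ I₄ ⟩
      N * (r * (M * (n + n)))     ≡⟨ solve (N ∷ r ∷ n ∷ M ∷ []) ⟩
      N * M * (r * (n + n))       ≡⟨ cong (N * M *_) r2n≡M+m ⟩
      N * M * (M + m)             ≡⟨ solve (N ∷ M ∷ m ∷ []) ⟩
      N * M * m + N * M * M       ∎)

<-by : ∀ {a b} → (∃ λ e → a + (1 + e) ≡ b) → a < b
<-by {a} (e , refl) = m<m+n a z<s

M≤r2n : ∀ {N M r n XW} → 0 < N * M → r * XW + N * (M * M) ≤ N * (r * (M * (n + n))) → M ≤ r * (n + n)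
M≤r2n {N} {M} {r} {n} {XW} NM>0 I₄ = *-cancelˡ-≤ (N * M) {{>-nonZero NM>0}} (begin
  N * M * M                  ≡⟨ *-assoc N M M ⟩
  N * (M * M)                ≤⟨ m≤n+m (N * (M * M)) (r * XW) ⟩
  r * XW + N * (M * M)       ≤⟨ I₄ ⟩
  N * (r * (M * (n + n)))    ≡⟨ solve (N ∷ M ∷ r ∷ n ∷ []) ⟩
  N * M * (r * (n + n))      ∎)
  where open ≤-Reasoning

-- N - 1 for r = 2 + t colours and n = 1 + k, that is (2r - 1)(n + 1) - 2.
Mof : ℕ → ℕ → ℕ
Mof t k = 4 + 3 * k + 4 * t + 2 * t * k

r2n<M+n : ∀ t k → (2 + t) * ((1 + k) + (1 + k)) < Mof t k + (1 + k)
r2n<M+n t k = <-by gap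
  where
  gap : ∃ λ e → (2 + t) * ((1 + k) + (1 + k)) + (1 + e) ≡ 4 + 3 * k + 4 * t + 2 * t * k + (1 + k)
  gap = 2 * t , solve (t ∷ k ∷ [])

M≤r2n⇒2t≤k : ∀ t k → Mof t k ≤ (2 + t) * ((1 + k) + (1 + k)) → 2 * t ≤ k
M≤r2n⇒2t≤k t k M≤r2n = +-cancelˡ-≤ (4 + 3 * k + 2 * t + 2 * t * k) (2 * t) k (begin
  4 + 3 * k + 2 * t + 2 * t * k + 2 * t   ≡⟨ solve (t ∷ k ∷ []) ⟩
  4 + 3 * k + 4 * t + 2 * t * k           ≤⟨ M≤r2n ⟩
  (2 + t) * ((1 + k) + (1 + k))           ≡⟨ solve (t ∷ k ∷ []) ⟩
  4 + 3 * k + 2 * t + 2 * t * k + k       ∎)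
  where open ≤-Reasoning

-- With k = 2t + m, A = M - 2n, V = (r - 1)(r - 2) and c = 2A - V the conclusion of
-- ramsey-inequalities⇒ fails by a polynomial gap in t and m.  Its only negative
-- coefficient is that of t·m², which the split t = 0 / t ≥ 1 absorbs.
ramsey-numerology : ∀ t k m → 2 * t + m ≡ k →
  let r = 2 + t
      n = 1 + k
      M = 4 + 3 * k + 4 * t + 2 * t * k
      A = (1 + 2 * t) * (2 + k)
      V = (1 + t) * t
      c = 4 + 2 * m + 11 * t + 4 * t * m + 7 * t * t
  in M ≡ A + (n + n) × r * (n + n) ≡ M + m × 2 * A ≡ c + V ×
     ∃ λ e → (2 * V * M + c) * m + r * (A * A) + (1 + e) ≡ r * c * A
ramsey-numerology zero .(2 * zero + m) m refl =
  solve (m ∷ []) , solve (m ∷ []) , solve (m ∷ []) , 7 + 4 * m , solve (m ∷ [])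
ramsey-numerology (suc t) .(2 * suc t + m) m refl =
  solve (t ∷ m ∷ []) , solve (t ∷ m ∷ []) , solve (t ∷ m ∷ []) ,
  359 + 104 * m + m * m + 936 * t + 218 * t * m + 3 * t * m * m + 962 * t * t
  + 165 * t * t * m + 2 * t * t * m * m + 488 * t * t * t + 53 * t * t * t * m
  + 122 * t * t * t * t + 6 * t * t * t * t * m + 12 * t * t * t * t * t ,
  solve (t ∷ m ∷ [])

ramsey-contradiction : ∀ t k {XF XW XZ} →
  let r = 2 + t
      n = 1 + k
      M = Mof t k
      N = suc M
      V = (1 + t) * t
  in N * (M * M) ≤ XF + XW + N * (M * (n + n)) →
     (∀ A → 2 * A * XF ≤ V * XZ + A * A * (N * M)) →
     XZ ≤ XF + (M * XW + M * XW) →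
     r * XW + N * (M * M) ≤ N * (r * (M * (n + n))) → ⊥
ramsey-contradiction t k {XF} {XW} {XZ} I₁ I₂ I₃ I₄ = impossible (m≤n⇒∃[o]m+o≡n 2t≤k)
  where
  r = 2 + t
  n = suc k
  M = Mof t k
  N = suc M
  A = (1 + 2 * t) * (2 + k)
  V = (1 + t) * t
  2t≤k : 2 * t ≤ k
  2t≤k = M≤r2n⇒2t≤k t k (M≤r2n {N} {M} {r} {n} {XW} z<s I₄)
  impossible : ∃ (λ m → 2 * t + m ≡ k) → ⊥
  impossible (m , 2t+m≡k) with ramsey-numerology t k m 2t+m≡k
  ... | M≡A+2n , r2n≡M+m , 2A≡c+V , gap = <⇒≱ (<-by gap)
    (ramsey-inequalities⇒ {r} {n} {M} {A} {V} {m} {c} M≡A+2n r2n≡M+m 2A≡c+V {N} {XF} {XW} {XZ}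
      z<s I₁ (I₂ A) I₃ I₄)
    where c = 4 + 2 * m + 11 * t + 4 * t * m + 7 * t * t

bound-identity : ∀ t k → suc (Mof t k) ≡ (2 * (2 + t) ∸ 1) * (suc k + 1) ∸ 1
bound-identity t k = normal-form t k
  where
  -- The right-hand side of bound-identity with its truncated subtractions computed away.
  normal-form : ∀ t k → 1 + (4 + 3 * k + 4 * t + 2 * t * k) ≡ k + 1 + (t + (2 + t + 0)) * (1 + k + 1)
  normal-form = solve-∀

no-good-edge-impossible : ∀ t k (χ : Colouring (2 + t) (suc (Mof t k))) →
  (∀ x y → ¬ ColourDegrees.Good χ (suc k) (suc k) x y) → ⊥
no-good-edge-impossible t k χ noGood = ramsey-contradiction t k
  (rainbowPairs+slackSum-bound noGood window) (rainbowPairs-am-gm noGood window)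
  (classPairs-bound noGood window) (slackSum-bound noGood window)
  where
  open Counting χ (suc k)
  window = degree-window noGood (r2n<M+n t k)

theorem1p5 : (r n : ℕ) → 2 ≤ r → 1 ≤ n →
    RamseyLe r n n ((2 * r ∸ 1) * (n + 1) ∸ 1)
theorem1p5 zero          _       ()            _
theorem1p5 (suc zero)    _       (s≤s ())      _
theorem1p5 (suc (suc t)) zero    _             ()
theorem1p5 (suc (suc t)) (suc k) _             _ = suc (Mof t k) , ≤-reflexive (bound-identity t k) , arrows
  where
  arrows : Arrows (suc (Mof t k)) (2 + t) (suc k) (suc k)
  arrows χ = [ id , ⊥-elim ∘ no-good-edge-impossible t k χ ]′
               (ColourDegrees.monoDoubleStar-or-noGood χ (suc k) (suc k))
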